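{- Let $n$ be a positive integer. If there exists a Kirkman frame of type $(3;6)^n$, then there exists a Kirkman triple system of order $18n+3$ which contains as a subdesign a Steiner triple system of order $9n$.
   Context: An STS$(v)$ is a set of $v$ points with a set of 3-subsets (blocks) such that each pair of distinct points lies in exactly one block; a KTS$(v)$ is an STS$(v)$ whose blocks partition into parallel classes; a subdesign is a subset of points with a subset of blocks forming an STS on that subset. A 3-GDD of type $g^u$ on a point set $V$ is a partition of $V$ into $u$ groups of size $g$ with 3-subset blocks, each meeting every group in at most one point, such that any two points in different groups lie in exactly one block. A Kirkman frame is a 3-GDD whose blocks can be partitioned into partial parallel classes, each a partition of $V\setminus V_i$ for some group $V_i$. A Kirkman frame of type $(g;h)^u$ is a Kirkman frame of type $h^u$ (groups $V_i$, blocks $\mathcal{B}$) together with a 3-GDD of type $g^u$ (groups $W_i$, blocks $\mathcal{A}$) with $W_i\subseteq V_i$ for all $i$ and $\mathcal{A}\subseteq\mathcal{B}$. -}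

module Defs where

open import Data.Nat using (ℕ; _*_; _+_)
open import Data.Bool using (Bool; true; false; _∧_; not)
open import Data.Fin using (Fin)
open import Data.Fin.Subset using (Subset; ∣_∣)
open import Data.Vec using (lookup; tabulate)
open import Data.List using (List; length; filterᵇ; concat; map)
open import Data.List.Relation.Unary.All using (All)
open import Data.List.Relation.Binary.Sublist.Propositional using (_⊆_)
open import Data.List.Relation.Binary.Permutation.Propositional using (_↭_)
open import Data.Product using (Σ; _×_; proj₁; proj₂; _,_)
open import Relation.Binary.PropositionalEquality using (_≡_; _≢_)
open import Relation.Nullary.Decidable using (⌊_⌋)
open import Data.Fin using (_≟_)

-- A point set is Fin v; a set of points / a block is a Subset v (a Vec Bool v).
-- A collection of blocks is a List (Subset v); counts are with multiplicity.

_∈ᵇ_ : ∀ {v} → Fin v → Subset v → Bool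
x ∈ᵇ s = lookup s x

count : ∀ {A : Set} → (A → Bool) → List A → ℕ
count p xs = length (filterᵇ p xs)

pairCount : ∀ {v} → List (Subset v) → Fin v → Fin v → ℕ
pairCount B x y = count (λ b → (x ∈ᵇ b) ∧ (y ∈ᵇ b)) B

pointCount : ∀ {v} → List (Subset v) → Fin v → ℕ
pointCount B x = count (λ b → x ∈ᵇ b) B

AllTriples : ∀ {v} → List (Subset v) → Set
AllTriples B = All (λ b → ∣ b ∣ ≡ 3) B

SubsetOf : ∀ {v} → Subset v → Subset v → Set
SubsetOf s t = ∀ x → x ∈ᵇ s ≡ true → x ∈ᵇ t ≡ true

IsSTS : (v : ℕ) → List (Subset v) → Set
IsSTS v B = AllTriples B × (∀ (x y : Fin v) → x ≢ y → pairCount B x y ≡ 1)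

IsParallelClass : ∀ {v} → List (Subset v) → Set
IsParallelClass {v} P = ∀ (x : Fin v) → pointCount P x ≡ 1

Resolvable : ∀ {v} → List (Subset v) → Set
Resolvable {v} B =
  Σ (List (List (Subset v))) λ classes →
    (concat classes ↭ B) × All IsParallelClass classes

IsKTS : (v : ℕ) → List (Subset v) → Set
IsKTS v B = IsSTS v B × Resolvable B

HasSubdesign : ∀ {v} → List (Subset v) → Subset v → Set
HasSubdesign {v} B S =
  Σ (List (Subset v)) λ A →
    (A ⊆ B)
    × All (λ a → SubsetOf a S) A
    × (∀ (x y : Fin v) → x ∈ᵇ S ≡ true → y ∈ᵇ S ≡ true → x ≢ y →
         pairCount A x y ≡ 1)

groupSet : ∀ {v u} → (Fin v → Fin u) → Fin u → Subset v
groupSet grp i = tabulate (λ x → ⌊ grp x ≟ i ⌋)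

_∩ᵇ_ : ∀ {v} → Subset v → Subset v → Subset v
s ∩ᵇ t = tabulate (λ x → (x ∈ᵇ s) ∧ (x ∈ᵇ t))

-- 3-GDD of type g^u on the point set W ⊆ Fin v, groups W_i = W ∩ grp⁻¹(i),
-- with block list A.
IsGDD : ∀ {v} (g u : ℕ) → Subset v → (Fin v → Fin u) → List (Subset v) → Set
IsGDD {v} g u W grp A =
  (∀ (i : Fin u) → ∣ W ∩ᵇ groupSet grp i ∣ ≡ g)
  × AllTriples A
  × All (λ a → SubsetOf a W) A
  × All (λ a → ∀ (x y : Fin v) → x ∈ᵇ a ≡ true → y ∈ᵇ a ≡ true →
                 grp x ≡ grp y → x ≡ y) A
  × (∀ (x y : Fin v) → x ∈ᵇ W ≡ true → y ∈ᵇ W ≡ true → grp x ≢ grp y →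
       pairCount A x y ≡ 1)

IsHoleClass : ∀ {v u} → (Fin v → Fin u) → Fin u → List (Subset v) → Set
IsHoleClass {v} grp i P =
  ∀ (x : Fin v) → (grp x ≡ i → pointCount P x ≡ 0)
                × (grp x ≢ i → pointCount P x ≡ 1)

-- Kirkman frame of type h^u on the point set Fin v (v = h*u is forced by
-- the group sizes), groups V_i = grp⁻¹(i), blocks B.
IsKirkmanFrame : ∀ {v} (h u : ℕ) → (Fin v → Fin u) → List (Subset v) → Set
IsKirkmanFrame {v} h u grp B =
  IsGDD h u (tabulate (λ _ → true)) grp B
  × Σ (List (Σ (Fin u) λ _ → List (Subset v))) λ classes →
      (concat (map proj₂ classes) ↭ B)
      × All (λ c → IsHoleClass grp (proj₁ c) (proj₂ c)) classes

KirkmanFrameGH : (g h u : ℕ) → Set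
KirkmanFrameGH g h u =
  Σ ℕ λ v →
  Σ (Fin v → Fin u) λ grp →
  Σ (List (Subset v)) λ B →
  Σ (Subset v) λ W →
  Σ (List (Subset v)) λ A →
    IsKirkmanFrame h u grp B
    × IsGDD g u W grp A
    × (A ⊆ B)

KTSWithSub : (v w : ℕ) → Set
KTSWithSub v w =
  Σ (List (Subset v)) λ B →
  Σ (Subset v) λ S →
    IsKTS v B × ∣ S ∣ ≡ w × HasSubdesign B S

module Submission where

-- Give every point weight 3: a frame block with coordinates ρ = 0, 1, 2 becomes the nine blocks
-- {(xᵨ, t + sρ)} of a resolvable TD(3,3), so each partial class with hole Vᵢ becomes three, and
-- V × ℤ/3 carries a frame of type (9;18)ⁿ. Counting blocks through a point shows that every group is
-- the hole of exactly three classes of the (3;6)ⁿ frame, hence of nine inflated ones. Adjoin ∞₀, ∞₁, ∞₂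
-- and fill each Vᵢ × ℤ/3 ∪ {∞₀, ∞₁, ∞₂} with a fixed KTS(21): nine of its classes complete the nine
-- partial classes of hole Vᵢ, and its tenth class, minus {∞₀, ∞₁, ∞₂}, joins those of the other groups
-- and {∞₀, ∞₁, ∞₂} in one more parallel class. Placing the sub-STS(9) of the KTS(21) on Wᵢ × ℤ/3, the
-- inflated blocks inside W (which cover the pairs of the 3-GDD) and these STS(9)s form an STS(9n).

open import Defs
open import Data.Nat using (ℕ; zero; suc; _+_; _*_; _≤_; _<_; z≤n; s≤s; NonZero; _≡ᵇ_; _<ᵇ_)
import Data.Nat as ℕ
open import Data.Nat.Properties hiding (_≟_)
open import Data.Nat.DivMod using (_mod_; m<n⇒m%n≡m)
open import Data.Nat.ListAction using () renaming (sum to sumˡ)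
open import Data.Nat.ListAction.Properties using () renaming (sum-++ to sumˡ-++; sum-↭ to sumˡ-↭)
open import Data.Nat.Solver using (module +-*-Solver)
open import Algebra.Properties.CommutativeMonoid.Sum +-0-commutativeMonoid
  using (sum; sum-cong-≗; sum-replicate-zero; ∑-distrib-+; ∑-comm)
open import Algebra.Properties.CommutativeSemigroup +-commutativeSemigroup
  using () renaming (interchange to +-interchange)
open import Data.Bool using (Bool; true; false; T; _∧_; _∨_; not; if_then_else_)
open import Data.Bool.Properties using (∧-idem; ∧-identityʳ; ∧-comm; ∧-zeroʳ)
open import Data.Fin using (Fin; zero; suc; toℕ; _≟_; splitAt; join; remQuot; quotRem; combine)
open import Data.Fin.Properties
  using (toℕ<n; toℕ-injective; toℕ-fromℕ<; combine-remQuot; join-splitAt) renaming (suc-injective to Fin-suc-injective)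
open import Data.Fin.Subset using (Subset; ∣_∣)
open import Data.Vec using ([]; _∷_; lookup; tabulate)
open import Data.Vec.Properties using (lookup∘tabulate)
open import Data.List using (List; []; _∷_; _++_; length; filterᵇ; concat; map; zipWith; allFin) renaming (tabulate to tabulateˡ)
open import Data.List.Properties using (map-++; length-map; length-++; concat-map)
open import Data.List.Relation.Unary.All using (All; []; _∷_)
import Data.List.Relation.Unary.All as All
import Data.List.Relation.Unary.All.Properties as All
open import Data.List.Relation.Binary.Sublist.Propositional using (_⊆_)
open import Data.List.Relation.Binary.Sublist.Heterogeneous.Core using ([]; _∷ʳ_; _∷_)
open import Data.List.Relation.Binary.Sublist.Propositional.Properties using () renaming (map⁺ to ⊆-map⁺)
open import Data.List.Relation.Binary.Permutation.Propositional using (_↭_; ↭-sym; ↭-reflexive)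
open import Data.List.Relation.Binary.Permutation.Propositional.Properties using (All-resp-↭) renaming (map⁺ to ↭-map⁺)
open import Data.Product using (Σ; _×_; proj₁; proj₂; _,_)
import Data.Product as Product
open import Data.Sum using (_⊎_; inj₁; inj₂; [_,_]′)
import Data.Sum as Sum
open import Data.Unit using (tt)
open import Data.Empty using (⊥-elim)
open import Relation.Nullary using (yes; no)
open import Relation.Nullary.Decidable using (⌊_⌋)
open import Relation.Binary.PropositionalEquality

private variable A B : Set

-- Finite sums and counting

𝟙 : Bool → ℕ
𝟙 true = 1
𝟙 false = 0

𝟙-+-𝟙-not : ∀ b → 𝟙 b + 𝟙 (not b) ≡ 1
𝟙-+-𝟙-not true = refl
𝟙-+-𝟙-not false = refl

𝟙-∧ : ∀ a b → 𝟙 (a ∧ b) ≡ 𝟙 a * 𝟙 b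
𝟙-∧ true b = sym (+-identityʳ (𝟙 b))
𝟙-∧ false b = refl

𝟙-∧-≤ : ∀ a b → 𝟙 (a ∧ b) ≤ 𝟙 a
𝟙-∧-≤ true true = s≤s z≤n
𝟙-∧-≤ true false = z≤n
𝟙-∧-≤ false b = z≤n

sumBy : (A → ℕ) → List A → ℕ
sumBy f xs = sumˡ (map f xs)

sumBy-zeroᴬ : ∀ {f : A → ℕ} {xs} → All (λ x → f x ≡ 0) xs → sumBy f xs ≡ 0
sumBy-zeroᴬ [] = refl
sumBy-zeroᴬ (e ∷ es) = cong₂ _+_ e (sumBy-zeroᴬ es)

sumBy-++ : ∀ (f : A → ℕ) xs ys → sumBy f (xs ++ ys) ≡ sumBy f xs + sumBy f ys
sumBy-++ f xs ys = trans (cong sumˡ (map-++ f xs ys)) (sumˡ-++ (map f xs) (map f ys))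

sumBy-↭ : ∀ (f : A → ℕ) {xs ys} → xs ↭ ys → sumBy f xs ≡ sumBy f ys
sumBy-↭ f p = sumˡ-↭ (↭-map⁺ f p)

sumBy-concat : ∀ (f : A → ℕ) xss → sumBy f (concat xss) ≡ sumBy (sumBy f) xss
sumBy-concat f [] = refl
sumBy-concat f (xs ∷ xss) = trans (sumBy-++ f xs (concat xss)) (cong (sumBy f xs +_) (sumBy-concat f xss))

sumBy-map : ∀ (f : B → ℕ) (g : A → B) xs → sumBy f (map g xs) ≡ sumBy (λ x → f (g x)) xs
sumBy-map f g [] = refl
sumBy-map f g (x ∷ xs) = cong (f (g x) +_) (sumBy-map f g xs)

sumBy-cong : ∀ {f g : A → ℕ} → (∀ x → f x ≡ g x) → ∀ xs → sumBy f xs ≡ sumBy g xs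
sumBy-cong e [] = refl
sumBy-cong e (x ∷ xs) = cong₂ _+_ (e x) (sumBy-cong e xs)

sumBy-congᴬ : ∀ {f g : A → ℕ} {xs} → All (λ x → f x ≡ g x) xs → sumBy f xs ≡ sumBy g xs
sumBy-congᴬ [] = refl
sumBy-congᴬ (e ∷ es) = cong₂ _+_ e (sumBy-congᴬ es)

sumBy-distrib-+ : ∀ (f g : A → ℕ) xs → sumBy (λ x → f x + g x) xs ≡ sumBy f xs + sumBy g xs
sumBy-distrib-+ f g [] = refl
sumBy-distrib-+ f g (x ∷ xs) =
  trans (cong (f x + g x +_) (sumBy-distrib-+ f g xs)) (+-interchange (f x) (g x) _ _)

sumBy-comm : ∀ (f : A → B → ℕ) xs ys →
             sumBy (λ x → sumBy (f x) ys) xs ≡ sumBy (λ y → sumBy (λ x → f x y) xs) ys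
sumBy-comm f [] ys = sym (sumBy-zeroᴬ (All.universal (λ _ → refl) ys))
sumBy-comm f (x ∷ xs) ys =
  trans (cong (sumBy (f x) ys +_) (sumBy-comm f xs ys))
        (sym (sumBy-distrib-+ (f x) (λ y → sumBy (λ x′ → f x′ y) xs) ys))

*-distribˡ-sumBy : ∀ c (f : A → ℕ) xs → sumBy (λ x → c * f x) xs ≡ c * sumBy f xs
*-distribˡ-sumBy c f [] = sym (*-zeroʳ c)
*-distribˡ-sumBy c f (x ∷ xs) =
  trans (cong (c * f x +_) (*-distribˡ-sumBy c f xs)) (sym (*-distribˡ-+ c (f x) _))

sumBy-const-1 : ∀ (xs : List A) → sumBy (λ _ → 1) xs ≡ length xs
sumBy-const-1 [] = refl
sumBy-const-1 (x ∷ xs) = cong suc (sumBy-const-1 xs)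

sumBy-mono : ∀ {f g : A → ℕ} → (∀ x → f x ≤ g x) → ∀ xs → sumBy f xs ≤ sumBy g xs
sumBy-mono e [] = z≤n
sumBy-mono e (x ∷ xs) = +-mono-≤ (e x) (sumBy-mono e xs)

sumBy-mono-⊆ : ∀ (f : A → ℕ) {xs ys} → xs ⊆ ys → sumBy f xs ≤ sumBy f ys
sumBy-mono-⊆ f [] = z≤n
sumBy-mono-⊆ f (y ∷ʳ s) = ≤-trans (sumBy-mono-⊆ f s) (m≤n+m _ (f y))
sumBy-mono-⊆ f (refl ∷ s) = +-monoʳ-≤ _ (sumBy-mono-⊆ f s)

sumBy-filterᵇ : ∀ (f : A → ℕ) (p : A → Bool) xs →
                sumBy f (filterᵇ p xs) ≡ sumBy (λ x → if p x then f x else 0) xs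
sumBy-filterᵇ f p [] = refl
sumBy-filterᵇ f p (x ∷ xs) with p x
... | true = cong (f x +_) (sumBy-filterᵇ f p xs)
... | false = sumBy-filterᵇ f p xs

count≡sumBy-𝟙 : ∀ (p : A → Bool) xs → count p xs ≡ sumBy (λ x → 𝟙 (p x)) xs
count≡sumBy-𝟙 p [] = refl
count≡sumBy-𝟙 p (x ∷ xs) with p x
... | true = cong suc (count≡sumBy-𝟙 p xs)
... | false = count≡sumBy-𝟙 p xs

count-∷ : ∀ (p : A → Bool) x xs → count p (x ∷ xs) ≡ 𝟙 (p x) + count p xs
count-∷ p x xs = trans (count≡sumBy-𝟙 p (x ∷ xs)) (cong (𝟙 (p x) +_) (sym (count≡sumBy-𝟙 p xs)))

count-cong : ∀ {p q : A → Bool} → (∀ x → p x ≡ q x) → ∀ xs → count p xs ≡ count q xs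
count-cong {p = p} {q = q} e xs = begin
  count p xs                ≡⟨ count≡sumBy-𝟙 p xs ⟩
  sumBy (λ x → 𝟙 (p x)) xs  ≡⟨ sumBy-cong (λ x → cong 𝟙 (e x)) xs ⟩
  sumBy (λ x → 𝟙 (q x)) xs  ≡⟨ count≡sumBy-𝟙 q xs ⟨
  count q xs                ∎
  where open ≡-Reasoning

count-congᴬ : ∀ {p q : A → Bool} {xs} → All (λ x → p x ≡ q x) xs → count p xs ≡ count q xs
count-congᴬ {p = p} {q = q} {xs = xs} e = begin
  count p xs                ≡⟨ count≡sumBy-𝟙 p xs ⟩
  sumBy (λ x → 𝟙 (p x)) xs  ≡⟨ sumBy-congᴬ (All.map (cong 𝟙) e) ⟩
  sumBy (λ x → 𝟙 (q x)) xs  ≡⟨ count≡sumBy-𝟙 q xs ⟨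
  count q xs                ∎
  where open ≡-Reasoning

count-zeroᴬ : ∀ {p : A → Bool} {xs} → All (λ x → p x ≡ false) xs → count p xs ≡ 0
count-zeroᴬ {p = p} {xs = xs} e = trans (count≡sumBy-𝟙 p xs) (sumBy-zeroᴬ (All.map (cong 𝟙) e))

count-false : ∀ (xs : List A) → count (λ _ → false) xs ≡ 0
count-false xs = count-zeroᴬ (All.universal (λ _ → refl) xs)

count-map : ∀ (p : B → Bool) (f : A → B) xs → count p (map f xs) ≡ count (λ x → p (f x)) xs
count-map p f xs = begin
  count p (map f xs)             ≡⟨ count≡sumBy-𝟙 p (map f xs) ⟩
  sumBy (λ y → 𝟙 (p y)) (map f xs) ≡⟨ sumBy-map (λ y → 𝟙 (p y)) f xs ⟩
  sumBy (λ x → 𝟙 (p (f x))) xs   ≡⟨ count≡sumBy-𝟙 (λ x → p (f x)) xs ⟨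
  count (λ x → p (f x)) xs       ∎
  where open ≡-Reasoning

count-++ : ∀ (p : A → Bool) xs ys → count p (xs ++ ys) ≡ count p xs + count p ys
count-++ p xs ys = begin
  count p (xs ++ ys)                                            ≡⟨ count≡sumBy-𝟙 p (xs ++ ys) ⟩
  sumBy (λ x → 𝟙 (p x)) (xs ++ ys)                              ≡⟨ sumBy-++ _ xs ys ⟩
  sumBy (λ x → 𝟙 (p x)) xs + sumBy (λ x → 𝟙 (p x)) ys           ≡⟨ cong₂ _+_ (count≡sumBy-𝟙 p xs) (count≡sumBy-𝟙 p ys) ⟨
  count p xs + count p ys                                       ∎
  where open ≡-Reasoning

count-concat : ∀ (p : A → Bool) xss → count p (concat xss) ≡ sumBy (count p) xss
count-concat p [] = refl
count-concat p (xs ∷ xss) = trans (count-++ p xs (concat xss)) (cong (count p xs +_) (count-concat p xss))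

count-filterᵇ : ∀ (p r : A → Bool) xs → count p (filterᵇ r xs) ≡ count (λ x → r x ∧ p x) xs
count-filterᵇ p r xs = begin
  count p (filterᵇ r xs)                              ≡⟨ count≡sumBy-𝟙 p (filterᵇ r xs) ⟩
  sumBy (λ x → 𝟙 (p x)) (filterᵇ r xs)                ≡⟨ sumBy-filterᵇ _ r xs ⟩
  sumBy (λ x → if r x then 𝟙 (p x) else 0) xs         ≡⟨ sumBy-cong pointwise xs ⟩
  sumBy (λ x → 𝟙 (r x ∧ p x)) xs                      ≡⟨ count≡sumBy-𝟙 _ xs ⟨
  count (λ x → r x ∧ p x) xs                          ∎
  where
  open ≡-Reasoning
  pointwise : ∀ x → (if r x then 𝟙 (p x) else 0) ≡ 𝟙 (r x ∧ p x)
  pointwise x with r x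
  ... | true = refl
  ... | false = refl

sumBy-count-zipWith-++ : ∀ (p : A → Bool) (xss yss : List (List A)) → length xss ≡ length yss →
  sumBy (count p) (zipWith _++_ xss yss) ≡ sumBy (count p) xss + sumBy (count p) yss
sumBy-count-zipWith-++ p [] [] e = refl
sumBy-count-zipWith-++ p (xs ∷ xss) (ys ∷ yss) e =
  trans (cong₂ _+_ (count-++ p xs ys) (sumBy-count-zipWith-++ p xss yss (suc-injective e)))
        (+-interchange (count p xs) (count p ys) _ _)

filterᵇ-⊆ : ∀ (p : A → Bool) xs → filterᵇ p xs ⊆ xs
filterᵇ-⊆ p [] = []
filterᵇ-⊆ p (x ∷ xs) with p x
... | true = refl ∷ filterᵇ-⊆ p xs
... | false = x ∷ʳ filterᵇ-⊆ p xs

All-filterᵇ : ∀ {Q : A → Set} (r : A → Bool) {xs} → All (λ x → r x ≡ true → Q x) xs → All Q (filterᵇ r xs)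
All-filterᵇ r {[]} [] = []
All-filterᵇ r {x ∷ xs} (h ∷ hs) with r x
... | true = h refl ∷ All-filterᵇ r hs
... | false = All-filterᵇ r hs

sum-const : ∀ m c → sum {m} (λ _ → c) ≡ m * c
sum-const zero c = refl
sum-const (suc m) c = cong (c +_) (sum-const m c)

sum-zero : ∀ {m} {f : Fin m → ℕ} → (∀ x → f x ≡ 0) → sum f ≡ 0
sum-zero {m} e = trans (sum-cong-≗ e) (sum-replicate-zero m)

sum-single : ∀ {m} (f : Fin m → ℕ) x → (∀ y → y ≢ x → f y ≡ 0) → sum f ≡ f x
sum-single {suc m} f zero e = trans (cong (f zero +_) (sum-zero (λ i → e (suc i) (λ ())))) (+-identityʳ _)
sum-single {suc m} f (suc x) e =
  trans (cong (_+ sum (λ i → f (suc i))) (e zero (λ ())))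
        (sum-single (λ i → f (suc i)) x (λ y y≢x → e (suc y) (λ q → y≢x (Fin-suc-injective q))))

*-distribˡ-sum : ∀ {m} c (f : Fin m → ℕ) → sum (λ x → c * f x) ≡ c * sum f
*-distribˡ-sum {zero} c f = sym (*-zeroʳ c)
*-distribˡ-sum {suc m} c f =
  trans (cong (c * f zero +_) (*-distribˡ-sum c (λ i → f (suc i)))) (sym (*-distribˡ-+ c (f zero) _))

sum-sumBy-comm : ∀ {m} (f : Fin m → A → ℕ) xs →
                 sum (λ y → sumBy (f y) xs) ≡ sumBy (λ x → sum (λ y → f y x)) xs
sum-sumBy-comm {m = m} f [] = sum-zero {m} (λ _ → refl)
sum-sumBy-comm f (x ∷ xs) =
  trans (∑-distrib-+ (λ y → f y x) (λ y → sumBy (f y) xs)) (cong (sum (λ y → f y x) +_) (sum-sumBy-comm f xs))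

sumBy-tabulate : ∀ {m} (f : A → ℕ) (g : Fin m → A) → sumBy f (tabulateˡ g) ≡ sum (λ i → f (g i))
sumBy-tabulate {m = zero} f g = refl
sumBy-tabulate {m = suc m} f g = cong (f (g zero) +_) (sumBy-tabulate f (λ i → g (suc i)))

sum-𝟙-nonzero : ∀ {m} (P : Fin m → Bool) {k} → sum (λ x → 𝟙 (P x)) ≡ suc k → Σ (Fin m) λ x → P x ≡ true
sum-𝟙-nonzero {suc m} P e with P zero in eq
... | true = zero , eq
... | false = Product.map suc (λ Px → Px) (sum-𝟙-nonzero (λ i → P (suc i)) e)

sum-splitAt : ∀ k m (g : Fin k ⊎ Fin m → ℕ) →
              sum {k + m} (λ q → g (splitAt k q)) ≡ sum (λ i → g (inj₁ i)) + sum (λ j → g (inj₂ j))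
sum-splitAt zero m g = refl
sum-splitAt (suc k) m g =
  trans (cong (g (inj₁ zero) +_) (sum-splitAt k m (λ s → g (Sum.map₁ suc s)))) (sym (+-assoc (g (inj₁ zero)) _ _))

sum-remQuot : ∀ v k (g : Fin v × Fin k → ℕ) → sum {v * k} (λ r → g (remQuot {v} k r)) ≡ sum (λ x → sum (λ α → g (x , α)))
sum-remQuot zero k g = refl
sum-remQuot (suc v) k g =
  trans (sum-splitAt k (v * k) (λ s → g (Product.swap ([ (λ j → j , zero) , (λ j → Product.map₂ suc (quotRem {v} k j)) ]′ s))))
        (cong (sum (λ α → g (zero , α)) +_) (sum-remQuot v k (λ p → g (suc (proj₁ p) , proj₂ p))))

∣∣≡sum-𝟙 : ∀ {v} (s : Subset v) → ∣ s ∣ ≡ sum (λ y → 𝟙 (lookup s y))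
∣∣≡sum-𝟙 [] = refl
∣∣≡sum-𝟙 (true ∷ s) = cong suc (∣∣≡sum-𝟙 s)
∣∣≡sum-𝟙 (false ∷ s) = ∣∣≡sum-𝟙 s

∣tabulate∣ : ∀ {v} (f : Fin v → Bool) → ∣ tabulate f ∣ ≡ sum (λ y → 𝟙 (f y))
∣tabulate∣ f = trans (∣∣≡sum-𝟙 (tabulate f)) (sum-cong-≗ (λ y → cong 𝟙 (lookup∘tabulate f y)))

sum-𝟙-∧ : ∀ {v} a (s : Subset v) → sum (λ y → 𝟙 (a ∧ lookup s y)) ≡ 𝟙 a * ∣ s ∣
sum-𝟙-∧ true s = trans (sym (∣∣≡sum-𝟙 s)) (sym (+-identityʳ ∣ s ∣))
sum-𝟙-∧ {v} false s = sum-zero {v} (λ _ → refl)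

rank : ∀ {v} → Subset v → Fin v → ℕ
rank (b ∷ s) zero = 0
rank (b ∷ s) (suc p) = 𝟙 b + rank s p

rank<∣∣ : ∀ {v} (s : Subset v) p → lookup s p ≡ true → rank s p < ∣ s ∣
rank<∣∣ (true ∷ s) zero e = s≤s z≤n
rank<∣∣ (true ∷ s) (suc p) e = s≤s (rank<∣∣ s p e)
rank<∣∣ (false ∷ s) (suc p) e = rank<∣∣ s p e

rank-injective : ∀ {v} (s : Subset v) p q → lookup s p ≡ true → lookup s q ≡ true → rank s p ≡ rank s q → p ≡ q
rank-injective (b ∷ s) zero zero ep eq e = refl
rank-injective (true ∷ s) zero (suc q) ep eq ()
rank-injective (true ∷ s) (suc p) zero ep eq ()
rank-injective (b ∷ s) (suc p) (suc q) ep eq e = cong suc (rank-injective s p q ep eq (+-cancelˡ-≡ (𝟙 b) _ _ e))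

sumBelow : ℕ → (ℕ → ℕ) → ℕ
sumBelow zero g = 0
sumBelow (suc k) g = g 0 + sumBelow k (λ m → g (suc m))

sumBelow-+ : ∀ a b (g : ℕ → ℕ) → sumBelow (a + b) g ≡ sumBelow a g + sumBelow b (λ m → g (a + m))
sumBelow-+ zero b g = refl
sumBelow-+ (suc a) b g = trans (cong (g 0 +_) (sumBelow-+ a b (λ m → g (suc m)))) (sym (+-assoc (g 0) _ _))

sum-by-rank : ∀ {v} (s : Subset v) (g : ℕ → ℕ) →
              sum (λ y → if lookup s y then g (rank s y) else 0) ≡ sumBelow ∣ s ∣ g
sum-by-rank [] g = refl
sum-by-rank (true ∷ s) g = cong (g 0 +_) (sum-by-rank s (λ m → g (suc m)))
sum-by-rank (false ∷ s) g = sum-by-rank s g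

_≟ᵇ_ : ∀ {m} → Fin m → Fin m → Bool
x ≟ᵇ y = ⌊ x ≟ y ⌋

≟ᵇ-refl : ∀ {m} (x : Fin m) → (x ≟ᵇ x) ≡ true
≟ᵇ-refl x with x ≟ x
... | yes _ = refl
... | no x≢x = ⊥-elim (x≢x refl)

≟ᵇ-≢ : ∀ {m} {x y : Fin m} → x ≢ y → (x ≟ᵇ y) ≡ false
≟ᵇ-≢ {x = x} {y} x≢y with x ≟ y
... | yes x≡y = ⊥-elim (x≢y x≡y)
... | no _ = refl

≟ᵇ-sound : ∀ {m} {x y : Fin m} → (x ≟ᵇ y) ≡ true → x ≡ y
≟ᵇ-sound {x = x} {y} e with x ≟ y
... | yes x≡y = x≡y

≟ᵇ-comm : ∀ {m} (x y : Fin m) → (x ≟ᵇ y) ≡ (y ≟ᵇ x)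
≟ᵇ-comm x y with x ≟ y | y ≟ x
... | yes _ | yes _ = refl
... | no _ | no _ = refl
... | yes x≡y | no y≢x = ⊥-elim (y≢x (sym x≡y))
... | no x≢y | yes y≡x = ⊥-elim (x≢y (sym y≡x))

sum-𝟙-≟ᵇ : ∀ {m} (x : Fin m) → sum (λ y → 𝟙 (x ≟ᵇ y)) ≡ 1
sum-𝟙-≟ᵇ x = trans (sum-single (λ y → 𝟙 (x ≟ᵇ y)) x (λ y y≢x → cong 𝟙 (≟ᵇ-≢ (λ e → y≢x (sym e)))))
                    (cong 𝟙 (≟ᵇ-refl x))

≡ᵇ-sound : ∀ m n → (m ≡ᵇ n) ≡ true → m ≡ n
≡ᵇ-sound m n e = ≡ᵇ⇒≡ m n (subst T (sym e) tt)

≡ᵇ-≢ : ∀ {m n} → m ≢ n → (m ≡ᵇ n) ≡ false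
≡ᵇ-≢ {m} {n} m≢n with m ≡ᵇ n in e
... | true = ⊥-elim (m≢n (≡ᵇ-sound m n e))
... | false = refl

∨-resolve : ∀ {a b} → a ≡ false → (a ∨ b) ≡ true → b ≡ true
∨-resolve refl e = e

allᵇ : ∀ {m} → (Fin m → Bool) → Bool
allᵇ {zero} f = true
allᵇ {suc m} f = f zero ∧ allᵇ (λ i → f (suc i))

allᵇ-sound : ∀ {m} (f : Fin m → Bool) → allᵇ f ≡ true → ∀ x → f x ≡ true
allᵇ-sound {suc m} f e x with f zero in e₀
allᵇ-sound {suc m} f e zero | true = e₀
allᵇ-sound {suc m} f e (suc x) | true = allᵇ-sound (λ i → f (suc i)) e x

allᵇ-complete : ∀ {m} (f : Fin m → Bool) → (∀ x → f x ≡ true) → allᵇ f ≡ true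
allᵇ-complete {zero} f e = refl
allᵇ-complete {suc m} f e rewrite e zero = allᵇ-complete (λ i → f (suc i)) (λ i → e (suc i))

allᵇ₂-sound : ∀ {m k} (f : Fin m → Fin k → Bool) → allᵇ (λ a → allᵇ (f a)) ≡ true → ∀ a b → f a b ≡ true
allᵇ₂-sound f e a = allᵇ-sound (f a) (allᵇ-sound (λ a → allᵇ (f a)) e a)

allᵇ₃-sound : ∀ {m k l} (f : Fin m → Fin k → Fin l → Bool) →
              allᵇ (λ a → allᵇ (λ b → allᵇ (f a b))) ≡ true → ∀ a b c → f a b c ≡ true
allᵇ₃-sound f e a b = allᵇ-sound (f a b) (allᵇ₂-sound (λ a b → allᵇ (f a b)) e a b)

allᵇ₄-sound : ∀ {m k l o} (f : Fin m → Fin k → Fin l → Fin o → Bool) →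
              allᵇ (λ a → allᵇ (λ b → allᵇ (λ c → allᵇ (f a b c)))) ≡ true → ∀ a b c d → f a b c d ≡ true
allᵇ₄-sound f e a b c = allᵇ-sound (f a b c) (allᵇ₃-sound (λ a b c → allᵇ (f a b c)) e a b c)

allInᵇ : ∀ {A : Set} → (A → Bool) → List A → Bool
allInᵇ f [] = true
allInᵇ f (x ∷ xs) = f x ∧ allInᵇ f xs

allInᵇ-sound : ∀ {A : Set} (f : A → Bool) xs → allInᵇ f xs ≡ true → All (λ x → f x ≡ true) xs
allInᵇ-sound f [] e = []
allInᵇ-sound f (x ∷ xs) e with f x in fx
... | true = fx ∷ allInᵇ-sound f xs e

allBelowᵇ : ℕ → (ℕ → Bool) → Bool
allBelowᵇ zero f = true
allBelowᵇ (suc k) f = allBelowᵇ k f ∧ f k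

allBelowᵇ-sound : ∀ k f → allBelowᵇ k f ≡ true → ∀ m → m < k → f m ≡ true
allBelowᵇ-sound (suc k) f e m m<1+k with allBelowᵇ k f in below | f k in atK | m ℕ.≟ k
... | true | true | yes refl = atK
... | true | true | no m≢k = allBelowᵇ-sound k f below m (≤∧≢⇒< (≤-pred m<1+k) m≢k)

_⊆ᵇ_ : ∀ {v} → Subset v → Subset v → Bool
a ⊆ᵇ w = allᵇ (λ z → not (lookup a z) ∨ lookup w z)

⊆ᵇ-complete : ∀ {v} (a w : Subset v) → SubsetOf a w → (a ⊆ᵇ w) ≡ true
⊆ᵇ-complete a w a⊆w = allᵇ-complete _ pointwise
  where
  pointwise : ∀ z → (not (lookup a z) ∨ lookup w z) ≡ true
  pointwise z with lookup a z in z∈a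
  ... | true = a⊆w z z∈a
  ... | false = refl

⊆ᵇ-sound : ∀ {v} (a w : Subset v) → (a ⊆ᵇ w) ≡ true → SubsetOf a w
⊆ᵇ-sound a w h z z∈a with allᵇ-sound _ h z
... | e rewrite z∈a = e

-- Group divisible designs and Kirkman frames

inGroup : ∀ {v u} → (Fin v → Fin u) → Fin u → Fin v → Bool
inGroup grp j x = grp x ≟ᵇ j

sum-𝟙-by-groups : ∀ {v u} (grp : Fin v → Fin u) (f : Fin v → Bool) →
                  sum (λ y → 𝟙 (f y)) ≡ sum (λ j → sum (λ y → 𝟙 (f y ∧ inGroup grp j y)))
sum-𝟙-by-groups {u = u} grp f = trans (sum-cong-≗ split) (∑-comm (λ y j → 𝟙 (f y ∧ inGroup grp j y)))
  where
  split : ∀ y → 𝟙 (f y) ≡ sum (λ j → 𝟙 (f y ∧ inGroup grp j y))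
  split y with f y
  ... | true = sym (sum-𝟙-≟ᵇ (grp y))
  ... | false = sym (sum-zero {u} (λ _ → refl))

module GDD {v g u} {W : Subset v} {grp : Fin v → Fin u} {A : List (Subset v)} (gdd : IsGDD g u W grp A) where

  open ≡-Reasoning

  groupPart-size : ∀ j → sum (λ y → 𝟙 (lookup W y ∧ inGroup grp j y)) ≡ g
  groupPart-size j = begin
    sum (λ y → 𝟙 (lookup W y ∧ inGroup grp j y))
      ≡⟨ sum-cong-≗ (λ y → cong (λ b → 𝟙 (lookup W y ∧ b)) (lookup∘tabulate _ y)) ⟨
    sum (λ y → 𝟙 (lookup W y ∧ lookup (groupSet grp j) y))
      ≡⟨ ∣tabulate∣ (λ y → lookup W y ∧ lookup (groupSet grp j) y) ⟨
    ∣ W ∩ᵇ groupSet grp j ∣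
      ≡⟨ proj₁ gdd j ⟩
    g ∎

  size : sum (λ y → 𝟙 (lookup W y)) ≡ u * g
  size = trans (sum-𝟙-by-groups grp (lookup W)) (trans (sum-cong-≗ groupPart-size) (sum-const u g))

  triples : AllTriples A
  triples = proj₁ (proj₂ gdd)

  blocks-⊆ : All (λ a → SubsetOf a W) A
  blocks-⊆ = proj₁ (proj₂ (proj₂ gdd))

  transversal : All (λ a → ∀ x y → x ∈ᵇ a ≡ true → y ∈ᵇ a ≡ true → grp x ≡ grp y → x ≡ y) A
  transversal = proj₁ (proj₂ (proj₂ (proj₂ gdd)))

  pairCount-otherGroup : ∀ x y → x ∈ᵇ W ≡ true → y ∈ᵇ W ≡ true → grp x ≢ grp y → pairCount A x y ≡ 1
  pairCount-otherGroup = proj₂ (proj₂ (proj₂ (proj₂ gdd)))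

  pairCount-sameGroup : ∀ x y → x ≢ y → grp x ≡ grp y → pairCount A x y ≡ 0
  pairCount-sameGroup x y x≢y same = count-zeroᴬ {p = λ a → lookup a x ∧ lookup a y} (All.map (λ {a} → notBoth a) transversal)
    where
    notBoth : ∀ a → (∀ x y → x ∈ᵇ a ≡ true → y ∈ᵇ a ≡ true → grp x ≡ grp y → x ≡ y) → (lookup a x ∧ lookup a y) ≡ false
    notBoth a meetsOnce with lookup a x in x∈a | lookup a y in y∈a
    ... | true | true = ⊥-elim (x≢y (meetsOnce x y x∈a y∈a same))
    ... | true | false = refl
    ... | false | _ = refl

sum-pairCount : ∀ {v} (B : List (Subset v)) x → sum (λ y → pairCount B x y) ≡ sumBy (λ b → 𝟙 (lookup b x) * ∣ b ∣) B
sum-pairCount B x = begin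
  sum (λ y → pairCount B x y)
    ≡⟨ sum-cong-≗ (λ y → count≡sumBy-𝟙 (λ b → lookup b x ∧ lookup b y) B) ⟩
  sum (λ y → sumBy (λ b → 𝟙 (lookup b x ∧ lookup b y)) B)
    ≡⟨ sum-sumBy-comm (λ y b → 𝟙 (lookup b x ∧ lookup b y)) B ⟩
  sumBy (λ b → sum (λ y → 𝟙 (lookup b x ∧ lookup b y))) B
    ≡⟨ sumBy-cong (λ b → sum-𝟙-∧ (lookup b x) b) B ⟩
  sumBy (λ b → 𝟙 (lookup b x) * ∣ b ∣) B ∎
  where open ≡-Reasoning

-- With c the number of hole classes per group and r the number of blocks through a point:
-- the first equation counts all classes, the second the points paired with a fixed point.
holeCount-equation : ∀ {u c r h} → 1 < u → u * c ≡ c + r → 2 * r + h ≡ u * h → 2 * c ≡ h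
holeCount-equation {suc (suc m)} {c} {r} {h} (s≤s (s≤s z≤n)) classes replication =
  *-cancelˡ-≡ (2 * c) h (suc m) (begin
    suc m * (2 * c)  ≡⟨ *-assoc (suc m) 2 c ⟨
    suc m * 2 * c    ≡⟨ cong (_* c) (*-comm (suc m) 2) ⟩
    2 * suc m * c    ≡⟨ *-assoc 2 (suc m) c ⟩
    2 * (suc m * c)  ≡⟨ cong (2 *_) (+-cancelˡ-≡ c _ _ classes) ⟩
    2 * r            ≡⟨ +-cancelʳ-≡ h (2 * r) (suc m * h) (trans replication (+-comm h (suc m * h))) ⟩
    suc m * h        ∎)
  where open ≡-Reasoning

module KirkmanFrameCounts {v h u} {grp : Fin v → Fin u} {B : List (Subset v)} (frame : IsKirkmanFrame h u grp B) where

  open ≡-Reasoning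

  module Blocks = GDD {W = tabulate (λ _ → true)} {grp = grp} {A = B} (proj₁ frame)

  private
    lookup-all : ∀ x → lookup (tabulate {n = v} (λ _ → true)) x ≡ true
    lookup-all = lookup∘tabulate (λ _ → true)

  groupSize : ∀ j → sum (λ y → 𝟙 (inGroup grp j y)) ≡ h
  groupSize j = trans (sum-cong-≗ (λ y → cong (λ b → 𝟙 (b ∧ inGroup grp j y)) (sym (lookup-all y)))) (Blocks.groupPart-size j)

  v≡u*h : v ≡ u * h
  v≡u*h = begin
    v                                                        ≡⟨ *-identityʳ v ⟨
    v * 1                                                    ≡⟨ sum-const v 1 ⟨
    sum {v} (λ _ → 1)                                        ≡⟨ sum-cong-≗ (λ y → cong 𝟙 (sym (lookup-all y))) ⟩
    sum {v} (λ y → 𝟙 (lookup (tabulate (λ _ → true)) y))     ≡⟨ Blocks.size ⟩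
    u * h                                                    ∎

  pairCount-otherGroup : ∀ x y → grp x ≢ grp y → pairCount B x y ≡ 1
  pairCount-otherGroup x y = Blocks.pairCount-otherGroup x y (lookup-all x) (lookup-all y)

  groupMember : .{{NonZero h}} → ∀ j → Σ (Fin v) λ x → grp x ≡ j
  groupMember j with sum-𝟙-nonzero (inGroup grp j) (trans (groupSize j) (sym (suc-pred h)))
  ... | x , x∈j = x , ≟ᵇ-sound x∈j

  replication : Fin v → ℕ
  replication x = pointCount B x

  classes : List (Σ (Fin u) λ _ → List (Subset v))
  classes = proj₁ (proj₂ frame)

  classes-↭ : concat (map proj₂ classes) ↭ B
  classes-↭ = proj₁ (proj₂ (proj₂ frame))

  classes-holes : All (λ c → IsHoleClass grp (proj₁ c) (proj₂ c)) classes
  classes-holes = proj₂ (proj₂ (proj₂ frame))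

  holeCount : Fin u → ℕ
  holeCount j = count (λ c → proj₁ c ≟ᵇ j) classes

  offGroup : Fin u → ℕ
  offGroup j = sum (λ y → 𝟙 (not (inGroup grp j y)))

  h+offGroup : ∀ j → h + offGroup j ≡ u * h
  h+offGroup j = begin
    h + offGroup j
      ≡⟨ cong (_+ offGroup j) (groupSize j) ⟨
    sum (λ y → 𝟙 (inGroup grp j y)) + offGroup j
      ≡⟨ ∑-distrib-+ (λ y → 𝟙 (inGroup grp j y)) _ ⟨
    sum (λ y → 𝟙 (inGroup grp j y) + 𝟙 (not (inGroup grp j y)))
      ≡⟨ sum-cong-≗ (λ y → 𝟙-+-𝟙-not (inGroup grp j y)) ⟩
    sum {v} (λ _ → 1)
      ≡⟨ sum-const v 1 ⟩
    v * 1
      ≡⟨ *-identityʳ v ⟩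
    v
      ≡⟨ v≡u*h ⟩
    u * h ∎

  sum-pairCount-by-triples : ∀ x → sum (λ y → pairCount B x y) ≡ 3 * replication x
  sum-pairCount-by-triples x = begin
    sum (λ y → pairCount B x y)
      ≡⟨ sum-pairCount B x ⟩
    sumBy (λ b → 𝟙 (lookup b x) * ∣ b ∣) B
      ≡⟨ sumBy-congᴬ (All.map (λ {b} ∣b∣≡3 → trans (cong (𝟙 (lookup b x) *_) ∣b∣≡3) (*-comm (𝟙 (lookup b x)) 3)) Blocks.triples) ⟩
    sumBy (λ b → 3 * 𝟙 (lookup b x)) B
      ≡⟨ *-distribˡ-sumBy 3 _ B ⟩
    3 * sumBy (λ b → 𝟙 (lookup b x)) B
      ≡⟨ cong (3 *_) (count≡sumBy-𝟙 _ B) ⟨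
    3 * replication x ∎

  sum-pairCount-by-groups : ∀ x → sum (λ y → pairCount B x y) ≡ replication x + offGroup (grp x)
  sum-pairCount-by-groups x = begin
    sum (λ y → pairCount B x y)
      ≡⟨ sum-cong-≗ pointwise ⟩
    sum (λ y → 𝟙 (x ≟ᵇ y) * replication x + 𝟙 (not (inGroup grp (grp x) y)))
      ≡⟨ ∑-distrib-+ (λ y → 𝟙 (x ≟ᵇ y) * replication x) _ ⟩
    sum (λ y → 𝟙 (x ≟ᵇ y) * replication x) + offGroup (grp x)
      ≡⟨ cong (_+ offGroup (grp x)) atX ⟩
    replication x + offGroup (grp x) ∎
    where
    atX : sum (λ y → 𝟙 (x ≟ᵇ y) * replication x) ≡ replication x
    atX = trans (sum-single _ x (λ y y≢x → cong (λ b → 𝟙 b * replication x) (≟ᵇ-≢ (λ e → y≢x (sym e)))))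
                (trans (cong (λ b → 𝟙 b * replication x) (≟ᵇ-refl x)) (+-identityʳ _))
    pointwise : ∀ y → pairCount B x y ≡ 𝟙 (x ≟ᵇ y) * replication x + 𝟙 (not (inGroup grp (grp x) y))
    pointwise y with x ≟ y
    ... | yes refl rewrite ≟ᵇ-refl (grp x) =
      trans (count-cong (λ b → ∧-idem (lookup b x)) B) (sym (trans (+-identityʳ _) (+-identityʳ _)))
    ... | no x≢y with grp y ≟ grp x
    ...   | yes same = Blocks.pairCount-sameGroup x y x≢y (sym same)
    ...   | no other = pairCount-otherGroup x y (λ e → other (sym e))

  twice-replication : ∀ x → 2 * replication x + h ≡ u * h
  twice-replication x = begin
    2 * replication x + h       ≡⟨ cong (_+ h) (+-cancelˡ-≡ (replication x) _ _ triples≡groups) ⟩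
    offGroup (grp x) + h        ≡⟨ +-comm (offGroup (grp x)) h ⟩
    h + offGroup (grp x)        ≡⟨ h+offGroup (grp x) ⟩
    u * h                       ∎
    where
    triples≡groups : 3 * replication x ≡ replication x + offGroup (grp x)
    triples≡groups = trans (sym (sum-pairCount-by-triples x)) (sum-pairCount-by-groups x)

  holeCount+replication : ∀ x → holeCount (grp x) + replication x ≡ length classes
  holeCount+replication x = begin
    holeCount (grp x) + replication x
      ≡⟨ cong₂ _+_ (count≡sumBy-𝟙 _ classes) (count≡sumBy-𝟙 _ B) ⟩
    sumBy isHole classes + sumBy (λ b → 𝟙 (lookup b x)) B
      ≡⟨ cong (sumBy isHole classes +_) (sumBy-↭ _ classes-↭) ⟨
    sumBy isHole classes + sumBy (λ b → 𝟙 (lookup b x)) (concat (map proj₂ classes))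
      ≡⟨ cong (sumBy isHole classes +_) (trans (sumBy-concat _ (map proj₂ classes)) (sumBy-map _ proj₂ classes)) ⟩
    sumBy isHole classes + sumBy (λ c → sumBy (λ b → 𝟙 (lookup b x)) (proj₂ c)) classes
      ≡⟨ cong (sumBy isHole classes +_) (sumBy-congᴬ (All.map (λ {c} → covers c) classes-holes)) ⟩
    sumBy isHole classes + sumBy (λ c → 𝟙 (not (proj₁ c ≟ᵇ grp x))) classes
      ≡⟨ sumBy-distrib-+ isHole _ classes ⟨
    sumBy (λ c → 𝟙 (proj₁ c ≟ᵇ grp x) + 𝟙 (not (proj₁ c ≟ᵇ grp x))) classes
      ≡⟨ sumBy-cong (λ c → 𝟙-+-𝟙-not (proj₁ c ≟ᵇ grp x)) classes ⟩
    sumBy (λ _ → 1) classes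
      ≡⟨ sumBy-const-1 classes ⟩
    length classes ∎
    where
    isHole : Σ (Fin u) (λ _ → List (Subset v)) → ℕ
    isHole c = 𝟙 (proj₁ c ≟ᵇ grp x)
    covers : ∀ c → IsHoleClass grp (proj₁ c) (proj₂ c) →
             sumBy (λ b → 𝟙 (lookup b x)) (proj₂ c) ≡ 𝟙 (not (proj₁ c ≟ᵇ grp x))
    covers c hole with grp x ≟ proj₁ c
    ... | yes e rewrite sym e | ≟ᵇ-refl (grp x) = trans (sym (count≡sumBy-𝟙 _ (proj₂ c))) (proj₁ (hole x) refl)
    ... | no ne rewrite ≟ᵇ-≢ (λ e → ne (sym e)) = trans (sym (count≡sumBy-𝟙 _ (proj₂ c))) (proj₂ (hole x) ne)

  sum-holeCount : sum holeCount ≡ length classes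
  sum-holeCount = begin
    sum holeCount                                         ≡⟨ sum-cong-≗ (λ j → count≡sumBy-𝟙 (λ c → proj₁ c ≟ᵇ j) classes) ⟩
    sum (λ j → sumBy (λ c → 𝟙 (proj₁ c ≟ᵇ j)) classes)    ≡⟨ sum-sumBy-comm (λ j c → 𝟙 (proj₁ c ≟ᵇ j)) classes ⟩
    sumBy (λ c → sum (λ j → 𝟙 (proj₁ c ≟ᵇ j))) classes    ≡⟨ sumBy-cong (λ c → sum-𝟙-≟ᵇ (proj₁ c)) classes ⟩
    sumBy (λ _ → 1) classes                               ≡⟨ sumBy-const-1 classes ⟩
    length classes                                        ∎

  twice-holeCount : .{{NonZero h}} → 1 < u → ∀ j → 2 * holeCount j ≡ h
  twice-holeCount 1<u j with groupMember j
  ... | x , refl = holeCount-equation 1<u (begin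
    u * holeCount (grp x)                    ≡⟨ sum-const u _ ⟨
    sum {u} (λ _ → holeCount (grp x))        ≡⟨ sum-cong-≗ (λ j → sym (holeCount-uniform j)) ⟩
    sum holeCount                            ≡⟨ sum-holeCount ⟩
    length classes                           ≡⟨ holeCount+replication x ⟨
    holeCount (grp x) + replication x        ∎) (twice-replication x)
    where
    replication-uniform : ∀ y → replication y ≡ replication x
    replication-uniform y = *-cancelˡ-≡ _ _ 2 (+-cancelʳ-≡ h _ _ (trans (twice-replication y) (sym (twice-replication x))))
    holeCount-uniform : ∀ j → holeCount j ≡ holeCount (grp x)
    holeCount-uniform j with groupMember j
    ... | y , refl = +-cancelʳ-≡ (replication x) _ _ (begin
      holeCount (grp y) + replication x   ≡⟨ cong (holeCount (grp y) +_) (replication-uniform y) ⟨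
      holeCount (grp y) + replication y   ≡⟨ holeCount+replication y ⟩
      length classes                      ≡⟨ holeCount+replication x ⟨
      holeCount (grp x) + replication x   ∎)

module SubframeCounts {v g h u} {grp : Fin v → Fin u} {B : List (Subset v)} {W : Subset v} {A : List (Subset v)}
  (frame : IsKirkmanFrame h u grp B) (gdd : IsGDD g u W grp A) (A⊆B : A ⊆ B) where

  module Frame = KirkmanFrameCounts {grp = grp} {B = B} frame
  module Sub = GDD {W = W} {grp = grp} {A = A} gdd

  pairCount-inside : ∀ x y → lookup W x ≡ true → lookup W y ≡ true → grp x ≢ grp y →
                     count (λ b → (lookup b x ∧ lookup b y) ∧ (b ⊆ᵇ W)) B ≡ 1
  pairCount-inside x y x∈W y∈W other = ≤-antisym atMost atLeast
    where
    atMost : count (λ b → (lookup b x ∧ lookup b y) ∧ (b ⊆ᵇ W)) B ≤ 1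
    atMost = begin
      count (λ b → (lookup b x ∧ lookup b y) ∧ (b ⊆ᵇ W)) B  ≡⟨ count≡sumBy-𝟙 _ B ⟩
      sumBy (λ b → 𝟙 ((lookup b x ∧ lookup b y) ∧ (b ⊆ᵇ W))) B ≤⟨ sumBy-mono (λ b → 𝟙-∧-≤ _ (b ⊆ᵇ W)) B ⟩
      sumBy (λ b → 𝟙 (lookup b x ∧ lookup b y)) B           ≡⟨ count≡sumBy-𝟙 _ B ⟨
      pairCount B x y                                       ≡⟨ Frame.pairCount-otherGroup x y other ⟩
      1                                                     ∎
      where open ≤-Reasoning
    atLeast : 1 ≤ count (λ b → (lookup b x ∧ lookup b y) ∧ (b ⊆ᵇ W)) B
    atLeast = begin
      1
        ≡⟨ Sub.pairCount-otherGroup x y x∈W y∈W other ⟨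
      pairCount A x y
        ≡⟨ count-congᴬ (All.map (λ {a} a⊆W → sym (flagTrue a a⊆W)) Sub.blocks-⊆) ⟩
      count (λ b → (lookup b x ∧ lookup b y) ∧ (b ⊆ᵇ W)) A
        ≡⟨ count≡sumBy-𝟙 _ A ⟩
      sumBy (λ b → 𝟙 ((lookup b x ∧ lookup b y) ∧ (b ⊆ᵇ W))) A
        ≤⟨ sumBy-mono-⊆ _ A⊆B ⟩
      sumBy (λ b → 𝟙 ((lookup b x ∧ lookup b y) ∧ (b ⊆ᵇ W))) B
        ≡⟨ count≡sumBy-𝟙 _ B ⟨
      count (λ b → (lookup b x ∧ lookup b y) ∧ (b ⊆ᵇ W)) B ∎
      where
      open ≤-Reasoning
      flagTrue : ∀ a → SubsetOf a W → ((lookup a x ∧ lookup a y) ∧ (a ⊆ᵇ W)) ≡ (lookup a x ∧ lookup a y)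
      flagTrue a a⊆W = trans (cong ((lookup a x ∧ lookup a y) ∧_) (⊆ᵇ-complete a W a⊆W)) (∧-identityʳ _)

-- The ingredients

-- The nine lines t + sρ of the affine plane over ℤ/3, ρ the coordinate and s the slope,
-- form a resolvable TD(3,3): the three lines of each slope are a parallel class.
𝔽₃ : List (Fin 3)
𝔽₃ = zero ∷ suc zero ∷ suc (suc zero) ∷ []

line : Fin 3 → Fin 3 → Fin 3 → Fin 3
line s t ρ = (toℕ t + toℕ s * toℕ ρ) mod 3

line-parallel : ∀ s ρ α → count (λ t → α ≟ᵇ line s t ρ) 𝔽₃ ≡ 1
line-parallel s ρ α =
  ≡ᵇ-sound _ _ (allᵇ₃-sound (λ s ρ α → count (λ t → α ≟ᵇ line s t ρ) 𝔽₃ ≡ᵇ 1) refl s ρ α)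

line-pair : ∀ ρ ρ′ α β → ρ ≢ ρ′ → sumBy (λ s → count (λ t → (α ≟ᵇ line s t ρ) ∧ (β ≟ᵇ line s t ρ′)) 𝔽₃) 𝔽₃ ≡ 1
line-pair ρ ρ′ α β ρ≢ρ′ = ≡ᵇ-sound _ _ (∨-resolve (≟ᵇ-≢ ρ≢ρ′) (allᵇ₄-sound check refl ρ ρ′ α β))
  where
  check : Fin 3 → Fin 3 → Fin 3 → Fin 3 → Bool
  check ρ ρ′ α β = (ρ ≟ᵇ ρ′) ∨ (sumBy (λ s → count (λ t → (α ≟ᵇ line s t ρ) ∧ (β ≟ᵇ line s t ρ′)) 𝔽₃) 𝔽₃ ≡ᵇ 1)

mod3-injective : ∀ r r′ → r < 3 → r′ < 3 → r mod 3 ≡ r′ mod 3 → r ≡ r′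
mod3-injective r r′ r<3 r′<3 e = begin
  r                    ≡⟨ trans (toℕ-fromℕ< _) (m<n⇒m%n≡m r<3) ⟨
  toℕ (r mod 3)        ≡⟨ cong toℕ e ⟩
  toℕ (r′ mod 3)       ≡⟨ trans (toℕ-fromℕ< _) (m<n⇒m%n≡m r′<3) ⟩
  r′                   ∎
  where open ≡-Reasoning

-- A KTS(21) on the labels 0..20 with a sub-STS(9) on 0..8: nine parallel classes,
-- and a tenth made of sixHoleBlocks (covering 0..17) and the block {18,19,20}.
Triple : Set
Triple = ℕ × ℕ × ℕ

_∋ᵗ_ : Triple → ℕ → Bool
(a , b , c) ∋ᵗ m = (m ≡ᵇ a) ∨ ((m ≡ᵇ b) ∨ (m ≡ᵇ c))

below9 : Triple → Bool
below9 (a , b , c) = (a <ᵇ 9) ∧ ((b <ᵇ 9) ∧ (c <ᵇ 9))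

nineClasses : List (List Triple)
nineClasses =
  ((0 , 5 , 7) ∷ (2 , 9 , 19) ∷ (1 , 10 , 15) ∷ (8 , 14 , 18) ∷ (4 , 17 , 20) ∷ (6 , 12 , 16) ∷ (3 , 11 , 13) ∷ [])
  ∷ ((1 , 4 , 7) ∷ (2 , 17 , 18) ∷ (8 , 10 , 13) ∷ (0 , 9 , 16) ∷ (6 , 15 , 20) ∷ (3 , 12 , 19) ∷ (5 , 11 , 14) ∷ [])
  ∷ ((2 , 5 , 8) ∷ (1 , 12 , 18) ∷ (0 , 14 , 20) ∷ (4 , 10 , 16) ∷ (3 , 9 , 17) ∷ (7 , 13 , 15) ∷ (6 , 11 , 19) ∷ [])
  ∷ ((2 , 3 , 7) ∷ (1 , 16 , 19) ∷ (8 , 11 , 17) ∷ (0 , 12 , 15) ∷ (4 , 13 , 18) ∷ (5 , 9 , 20) ∷ (6 , 10 , 14) ∷ [])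
  ∷ ((1 , 3 , 8) ∷ (2 , 14 , 16) ∷ (0 , 11 , 18) ∷ (4 , 9 , 15) ∷ (7 , 12 , 20) ∷ (6 , 13 , 17) ∷ (5 , 10 , 19) ∷ [])
  ∷ ((0 , 3 , 6) ∷ (2 , 11 , 15) ∷ (1 , 9 , 13) ∷ (8 , 16 , 20) ∷ (4 , 14 , 19) ∷ (5 , 12 , 17) ∷ (7 , 10 , 18) ∷ [])
  ∷ ((1 , 5 , 6) ∷ (2 , 13 , 20) ∷ (8 , 15 , 19) ∷ (0 , 10 , 17) ∷ (4 , 11 , 12) ∷ (3 , 16 , 18) ∷ (7 , 9 , 14) ∷ [])
  ∷ ((2 , 4 , 6) ∷ (1 , 14 , 17) ∷ (8 , 9 , 12) ∷ (0 , 13 , 19) ∷ (3 , 10 , 20) ∷ (5 , 15 , 18) ∷ (7 , 11 , 16) ∷ [])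
  ∷ ((0 , 4 , 8) ∷ (2 , 10 , 12) ∷ (1 , 11 , 20) ∷ (6 , 9 , 18) ∷ (3 , 14 , 15) ∷ (5 , 13 , 16) ∷ (7 , 17 , 19) ∷ [])
  ∷ []

sixHoleBlocks : List Triple
sixHoleBlocks = (0 , 1 , 2) ∷ (3 , 4 , 5) ∷ (6 , 7 , 8) ∷ (9 , 10 , 11) ∷ (12 , 13 , 14) ∷ (15 , 16 , 17) ∷ []

fillBlocks : List Triple
fillBlocks = concat nineClasses ++ sixHoleBlocks

nineClasses-parallel : All (λ C → ∀ m → m < 21 → count (_∋ᵗ m) C ≡ 1) nineClasses
nineClasses-parallel =
  All.map (λ {C} e m m<21 → ≡ᵇ-sound _ _ (allBelowᵇ-sound 21 (λ m → count (_∋ᵗ m) C ≡ᵇ 1) e m m<21))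
          (allInᵇ-sound (λ C → allBelowᵇ 21 (λ m → count (_∋ᵗ m) C ≡ᵇ 1)) nineClasses refl)

sixHoleBlocks-cover : ∀ m → m < 18 → count (_∋ᵗ m) sixHoleBlocks ≡ 1
sixHoleBlocks-cover m m<18 = ≡ᵇ-sound _ _ (allBelowᵇ-sound 18 (λ m → count (_∋ᵗ m) sixHoleBlocks ≡ᵇ 1) refl m m<18)

sixHoleBlocks-miss-∞ : ∀ (k : Fin 3) → count (_∋ᵗ (18 + toℕ k)) sixHoleBlocks ≡ 0
sixHoleBlocks-miss-∞ k = ≡ᵇ-sound _ _ (allᵇ-sound (λ k → count (_∋ᵗ (18 + toℕ k)) sixHoleBlocks ≡ᵇ 0) refl k)

fill-pairCount : ∀ m m′ → m < 18 → m′ < 21 → m ≢ m′ → count (λ d → (d ∋ᵗ m) ∧ (d ∋ᵗ m′)) fillBlocks ≡ 1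
fill-pairCount m m′ m<18 m′<21 m≢m′ =
  ≡ᵇ-sound _ _ (∨-resolve (≡ᵇ-≢ m≢m′)
    (allBelowᵇ-sound 21 (check m) (allBelowᵇ-sound 18 (λ m → allBelowᵇ 21 (check m)) refl m m<18) m′ m′<21))
  where
  check : ℕ → ℕ → Bool
  check m m′ = (m ≡ᵇ m′) ∨ (count (λ d → (d ∋ᵗ m) ∧ (d ∋ᵗ m′)) fillBlocks ≡ᵇ 1)

fill-pairCount-∞ : ∀ (k k′ : Fin 3) → k ≢ k′ → count (λ d → (d ∋ᵗ (18 + toℕ k)) ∧ (d ∋ᵗ (18 + toℕ k′))) fillBlocks ≡ 0
fill-pairCount-∞ k k′ k≢k′ = ≡ᵇ-sound _ _ (∨-resolve (≟ᵇ-≢ k≢k′) (allᵇ₂-sound check refl k k′))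
  where
  check : Fin 3 → Fin 3 → Bool
  check k k′ = (k ≟ᵇ k′) ∨ (count (λ d → (d ∋ᵗ (18 + toℕ k)) ∧ (d ∋ᵗ (18 + toℕ k′))) fillBlocks ≡ᵇ 0)

fill-subPairCount : ∀ m m′ → m < 9 → m′ < 9 → m ≢ m′ → count (λ d → below9 d ∧ ((d ∋ᵗ m) ∧ (d ∋ᵗ m′))) fillBlocks ≡ 1
fill-subPairCount m m′ m<9 m′<9 m≢m′ =
  ≡ᵇ-sound _ _ (∨-resolve (≡ᵇ-≢ m≢m′)
    (allBelowᵇ-sound 9 (check m) (allBelowᵇ-sound 9 (λ m → allBelowᵇ 9 (check m)) refl m m<9) m′ m′<9))
  where
  check : ℕ → ℕ → Bool
  check m m′ = (m ≡ᵇ m′) ∨ (count (λ d → below9 d ∧ ((d ∋ᵗ m) ∧ (d ∋ᵗ m′))) fillBlocks ≡ᵇ 1)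

-- The labels of d, counted the way the construction labels a group:
-- position m < 6 of a group point, times 3, plus its layer α; then 18 + k for ∞ₖ.
labelCount : Triple → ℕ
labelCount d = sumBelow 6 (λ m → sum (λ (α : Fin 3) → 𝟙 (d ∋ᵗ (m * 3 + toℕ α)))) + sum (λ (k : Fin 3) → 𝟙 (d ∋ᵗ (18 + toℕ k)))

fill-labelCount : All (λ d → labelCount d ≡ 3) fillBlocks
fill-labelCount = All.map (λ e → ≡ᵇ-sound _ _ e) (allInᵇ-sound (λ d → labelCount d ≡ᵇ 3) fillBlocks refl)

below9-∋ᵗ : ∀ d m → below9 d ≡ true → (d ∋ᵗ m) ≡ true → m < 9
below9-∋ᵗ (a , b , c) m below m∈d with a <ᵇ 9 in a<9 | b <ᵇ 9 in b<9 | c <ᵇ 9 in c<9 | m ≡ᵇ a in m≡a | m ≡ᵇ b in m≡b | m ≡ᵇ c in m≡c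
... | true | true | true | true | _ | _ rewrite ≡ᵇ-sound m a m≡a = <ᵇ⇒< a 9 (subst T (sym a<9) tt)
... | true | true | true | false | true | _ rewrite ≡ᵇ-sound m b m≡b = <ᵇ⇒< b 9 (subst T (sym b<9) tt)
... | true | true | true | false | false | true rewrite ≡ᵇ-sound m c m≡c = <ᵇ⇒< c 9 (subst T (sym c<9) tt)
below9-∋ᵗ (a , b , c) m below () | true | true | true | false | false | false
below9-∋ᵗ (a , b , c) m () m∈d | true | true | false | _ | _ | _
below9-∋ᵗ (a , b , c) m () m∈d | true | false | _ | _ | _ | _
below9-∋ᵗ (a , b , c) m () m∈d | false | _ | _ | _ | _ | _

tripleSubset : Triple → Subset 21
tripleSubset d = tabulate (λ q → d ∋ᵗ toℕ q)

kts21-classes : List (List Triple)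
kts21-classes = nineClasses ++ (((18 , 19 , 20) ∷ sixHoleBlocks) ∷ [])

kts21 : KTSWithSub 21 9
kts21 = blocks , sub9 , (sts , resolution) , refl , subdesign
  where
  blocks : List (Subset 21)
  blocks = map tripleSubset (concat kts21-classes)
  sub9 : Subset 21
  sub9 = tabulate (λ q → toℕ q <ᵇ 9)
  subBlocks : List (Subset 21)
  subBlocks = map tripleSubset (filterᵇ below9 (concat kts21-classes))
  sts : IsSTS 21 blocks
  sts = All.map⁺ {f = tripleSubset} (All.map (λ e → ≡ᵇ-sound _ _ e) (allInᵇ-sound (λ d → ∣ tripleSubset d ∣ ≡ᵇ 3) (concat kts21-classes) refl))
      , λ x y x≢y → ≡ᵇ-sound _ _ (∨-resolve (≟ᵇ-≢ x≢y) (allᵇ₂-sound (λ x y → (x ≟ᵇ y) ∨ (pairCount blocks x y ≡ᵇ 1)) refl x y))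
  resolution : Resolvable blocks
  resolution = map (map tripleSubset) kts21-classes , ↭-reflexive (concat-map {f = tripleSubset} kts21-classes)
             , All.map⁺ {f = map tripleSubset} (All.map (λ {C} e x → ≡ᵇ-sound _ _ (allᵇ-sound (λ x → pointCount (map tripleSubset C) x ≡ᵇ 1) e x))
                 (allInᵇ-sound (λ C → allᵇ (λ x → pointCount (map tripleSubset C) x ≡ᵇ 1)) kts21-classes refl))
  subdesign : HasSubdesign blocks sub9
  subdesign = subBlocks , ⊆-map⁺ tripleSubset (filterᵇ-⊆ below9 (concat kts21-classes))
            , All.map⁺ {f = tripleSubset} (All.map (λ {d} e → ⊆ᵇ-sound (tripleSubset d) sub9 e)
                (allInᵇ-sound (λ d → tripleSubset d ⊆ᵇ sub9) (filterᵇ below9 (concat kts21-classes)) refl))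
            , λ x y x∈ y∈ x≢y → ≡ᵇ-sound _ _ (∨-resolve (≟ᵇ-≢ x≢y) (∨-resolve (cong not y∈) (∨-resolve (cong not x∈)
                (allᵇ₂-sound (λ x y → not (lookup sub9 x) ∨ (not (lookup sub9 y) ∨ ((x ≟ᵇ y) ∨ (pairCount subBlocks x y ≡ᵇ 1)))) refl x y))))

-- The construction

holesAt : ∀ {n} {X : Set} → Fin n → List (Σ (Fin n) λ _ → List X) → List (List X)
holesAt i cs = map proj₂ (filterᵇ (λ c → proj₁ c ≟ᵇ i) cs)

holesAt-All : ∀ {n} {X : Set} (R : Fin n → List X → Set) i cs →
              All (λ c → R (proj₁ c) (proj₂ c)) cs → All (R i) (holesAt i cs)
holesAt-All R i [] [] = []
holesAt-All R i (c ∷ cs) (h ∷ hs) with proj₁ c ≟ᵇ i in e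
... | true = subst (λ j → R j (proj₂ c)) (≟ᵇ-sound e) h ∷ holesAt-All R i cs hs
... | false = holesAt-All R i cs hs

sum-holesAt : ∀ {n} {X : Set} (f : List X → ℕ) cs → sum {n} (λ i → sumBy f (holesAt i cs)) ≡ sumBy (λ c → f (proj₂ c)) cs
sum-holesAt {n} f cs = begin
  sum (λ i → sumBy f (holesAt i cs))
    ≡⟨ sum-cong-≗ (λ i → trans (sumBy-map f proj₂ (filterᵇ (λ c → proj₁ c ≟ᵇ i) cs))
                                (sumBy-filterᵇ (λ c → f (proj₂ c)) (λ c → proj₁ c ≟ᵇ i) cs)) ⟩
  sum (λ i → sumBy (λ c → if proj₁ c ≟ᵇ i then f (proj₂ c) else 0) cs)
    ≡⟨ sum-sumBy-comm (λ i c → if proj₁ c ≟ᵇ i then f (proj₂ c) else 0) cs ⟩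
  sumBy (λ c → sum (λ i → if proj₁ c ≟ᵇ i then f (proj₂ c) else 0)) cs
    ≡⟨ sumBy-cong (λ c → trans (sum-single _ (proj₁ c) (offHole c)) (atHole c)) cs ⟩
  sumBy (λ c → f (proj₂ c)) cs ∎
  where
  open ≡-Reasoning
  offHole : ∀ c i → i ≢ proj₁ c → (if proj₁ c ≟ᵇ i then f (proj₂ c) else 0) ≡ 0
  offHole c i i≢c rewrite ≟ᵇ-≢ (λ e → i≢c (sym e)) = refl
  atHole : ∀ c → (if proj₁ c ≟ᵇ proj₁ c then f (proj₂ c) else 0) ≡ f (proj₂ c)
  atHole c rewrite ≟ᵇ-refl (proj₁ c) = refl

*3+-injective : ∀ a a′ (α β : Fin 3) → a * 3 + toℕ α ≡ a′ * 3 + toℕ β → a ≡ a′ × α ≡ β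
*3+-injective zero zero α β e = refl , toℕ-injective e
*3+-injective zero (suc a′) α β e = ⊥-elim (<-irrefl e (≤-trans (toℕ<n α) (m≤m+n 3 (a′ * 3 + toℕ β))))
*3+-injective (suc a) zero α β e = ⊥-elim (<-irrefl (sym e) (≤-trans (toℕ<n β) (m≤m+n 3 (a * 3 + toℕ α))))
*3+-injective (suc a) (suc a′) α β e with *3+-injective a a′ α β (suc-injective (suc-injective (suc-injective e)))
... | refl , α≡β = refl , α≡β

*3+-< : ∀ a (α : Fin 3) k → a < k → a * 3 + toℕ α < k * 3
*3+-< a α k a<k = ≤-trans (+-monoʳ-< (a * 3) (toℕ<n α)) (≤-trans (≤-reflexive (+-comm (a * 3) 3)) (*-monoˡ-≤ 3 a<k))

module Construction {n v : ℕ} (grp : Fin v → Fin n) (B : List (Subset v)) (W : Subset v) (A : List (Subset v))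
  (frame : IsKirkmanFrame 6 n grp B) (gdd : IsGDD 3 n W grp A) (A⊆B : A ⊆ B) (1<n : 1 < n) where

  open ≡-Reasoning
  module Frame = KirkmanFrameCounts {grp = grp} {B = B} frame
  module Sub = GDD {W = W} {grp = grp} {A = A} gdd
  module Subframe = SubframeCounts {grp = grp} {B = B} {W = W} {A = A} frame gdd A⊆B

  _∈ᵍ_ : Fin v → Fin n → Bool
  x ∈ᵍ i = inGroup grp i x

  Point : Set
  Point = (Fin v × Fin 3) ⊎ Fin 3

  Block : Set
  Block = Point → Bool

  -- The flag records membership of the subdesign on W × 𝔽₃.
  TaggedBlock : Set
  TaggedBlock = Block × Bool

  coordinate : Subset v → Fin v → Fin 3
  coordinate b p = rank b p mod 3

  inflate : Subset v → Fin 3 → Fin 3 → Block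
  inflate b s t (inj₁ (p , α)) = lookup b p ∧ (α ≟ᵇ line s t (coordinate b p))
  inflate b s t (inj₂ k) = false

  wPart restPart : Fin n → Subset v
  wPart i = tabulate (λ x → lookup W x ∧ (x ∈ᵍ i))
  restPart i = tabulate (λ x → not (lookup W x) ∧ (x ∈ᵍ i))

  -- Positions 0, 1, 2 go to the points of W, so that their labels 0..8 carry the sub-STS(9).
  position : Fin n → Fin v → ℕ
  position i x = if lookup W x then rank (wPart i) x else 3 + rank (restPart i) x

  inFill : Fin n → Point → Bool
  inFill i (inj₁ (p , α)) = p ∈ᵍ i
  inFill i (inj₂ k) = true

  label : Fin n → Point → ℕ
  label i (inj₁ (p , α)) = position i p * 3 + toℕ α
  label i (inj₂ k) = 18 + toℕ k

  fill : Fin n → Triple → Block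
  fill i d q = inFill i q ∧ (d ∋ᵗ label i q)

  ∞Block : Block
  ∞Block (inj₁ _) = false
  ∞Block (inj₂ _) = true

  inflated : Subset v → Fin 3 → Fin 3 → TaggedBlock
  inflated b s t = inflate b s t , b ⊆ᵇ W

  filled : Fin n → Triple → TaggedBlock
  filled i d = fill i d , below9 d

  ∞tagged : TaggedBlock
  ∞tagged = ∞Block , false

  inflateClass : List (Subset v) → Fin 3 → List TaggedBlock
  inflateClass P s = concat (map (λ b → map (inflated b s) 𝔽₃) P)

  inflateAll : Subset v → List TaggedBlock
  inflateAll b = concat (map (λ s → map (inflated b s) 𝔽₃) 𝔽₃)

  inflatedHoleClasses : Fin n → List (List TaggedBlock)
  inflatedHoleClasses i = concat (map (λ P → map (inflateClass P) 𝔽₃) (holesAt i Frame.classes))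

  groupClasses : Fin n → List (List TaggedBlock)
  groupClasses i = zipWith _++_ (inflatedHoleClasses i) (map (map (filled i)) nineClasses)

  ∞Class : List TaggedBlock
  ∞Class = ∞tagged ∷ concat (map (λ i → map (filled i) sixHoleBlocks) (allFin n))

  resolution : List (List TaggedBlock)
  resolution = ∞Class ∷ concat (map groupClasses (allFin n))

  blocks : List TaggedBlock
  blocks = concat resolution

  holeCount≡3 : ∀ i → Frame.holeCount i ≡ 3
  holeCount≡3 i = *-cancelˡ-≡ (Frame.holeCount i) 3 2 (Frame.twice-holeCount 1<n i)

  length-inflatedHoleClasses : ∀ i → length (inflatedHoleClasses i) ≡ length (map (map (filled i)) nineClasses)
  length-inflatedHoleClasses i = begin
    length (inflatedHoleClasses i)
      ≡⟨ length-triple (holesAt i Frame.classes) ⟩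
    length (holesAt i Frame.classes) * 3
      ≡⟨ cong (_* 3) (trans (length-map proj₂ (filterᵇ _ Frame.classes)) (holeCount≡3 i)) ⟩
    9 ∎
    where
    length-triple : ∀ Ps → length (concat (map (λ P → map (inflateClass P) 𝔽₃) Ps)) ≡ length Ps * 3
    length-triple [] = refl
    length-triple (P ∷ Ps) =
      trans (length-++ (map (inflateClass P) 𝔽₃) {concat (map (λ P → map (inflateClass P) 𝔽₃) Ps)}) (cong (3 +_) (length-triple Ps))

  inflateSum : (TaggedBlock → Bool) → ℕ
  inflateSum p = sumBy (λ b → count p (inflateAll b)) B

  fillSum : (TaggedBlock → Bool) → ℕ
  fillSum p = sum (λ i → count p (map (filled i) fillBlocks))

  count-inflateClass : ∀ p P s → count p (inflateClass P s) ≡ sumBy (λ b → count p (map (inflated b s) 𝔽₃)) P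
  count-inflateClass p P s =
    trans (count-concat p (map (λ b → map (inflated b s) 𝔽₃) P)) (sumBy-map (count p) (λ b → map (inflated b s) 𝔽₃) P)

  count-inflateAll-byClass : ∀ p b → count p (inflateAll b) ≡ sumBy (λ s → count p (map (inflated b s) 𝔽₃)) 𝔽₃
  count-inflateAll-byClass p b =
    trans (count-concat p (map (λ s → map (inflated b s) 𝔽₃) 𝔽₃)) (sumBy-map (count p) (λ s → map (inflated b s) 𝔽₃) 𝔽₃)

  count-inflatedHoleClasses : ∀ p i →
    sumBy (count p) (inflatedHoleClasses i) ≡ sumBy (λ P → sumBy (λ b → count p (inflateAll b)) P) (holesAt i Frame.classes)
  count-inflatedHoleClasses p i = begin
    sumBy (count p) (inflatedHoleClasses i)
      ≡⟨ sumBy-concat (count p) (map (λ P → map (inflateClass P) 𝔽₃) Ps) ⟩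
    sumBy (sumBy (count p)) (map (λ P → map (inflateClass P) 𝔽₃) Ps)
      ≡⟨ sumBy-map (sumBy (count p)) (λ P → map (inflateClass P) 𝔽₃) Ps ⟩
    sumBy (λ P → sumBy (count p) (map (inflateClass P) 𝔽₃)) Ps
      ≡⟨ sumBy-cong (λ P → trans (sumBy-map (count p) (inflateClass P) 𝔽₃) (sumBy-cong (count-inflateClass p P) 𝔽₃)) Ps ⟩
    sumBy (λ P → sumBy (λ s → sumBy (λ b → count p (map (inflated b s) 𝔽₃)) P) 𝔽₃) Ps
      ≡⟨ sumBy-cong (λ P → sumBy-comm (λ s b → count p (map (inflated b s) 𝔽₃)) 𝔽₃ P) Ps ⟩
    sumBy (λ P → sumBy (λ b → sumBy (λ s → count p (map (inflated b s) 𝔽₃)) 𝔽₃) P) Ps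
      ≡⟨ sumBy-cong (λ P → sumBy-cong (λ b → sym (count-inflateAll-byClass p b)) P) Ps ⟩
    sumBy (λ P → sumBy (λ b → count p (inflateAll b)) P) Ps ∎
    where
    Ps = holesAt i Frame.classes

  -- Every block of B is inflated exactly once, in the classes of its hole.
  sum-count-inflatedHoleClasses : ∀ p → sum (λ i → sumBy (count p) (inflatedHoleClasses i)) ≡ inflateSum p
  sum-count-inflatedHoleClasses p = begin
    sum (λ i → sumBy (count p) (inflatedHoleClasses i))
      ≡⟨ sum-cong-≗ (count-inflatedHoleClasses p) ⟩
    sum (λ i → sumBy (sumBy (λ b → count p (inflateAll b))) (holesAt i Frame.classes))
      ≡⟨ sum-holesAt (sumBy (λ b → count p (inflateAll b))) Frame.classes ⟩
    sumBy (λ c → sumBy (λ b → count p (inflateAll b)) (proj₂ c)) Frame.classes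
      ≡⟨ sumBy-map _ proj₂ Frame.classes ⟨
    sumBy (sumBy (λ b → count p (inflateAll b))) (map proj₂ Frame.classes)
      ≡⟨ sumBy-concat _ (map proj₂ Frame.classes) ⟨
    sumBy (λ b → count p (inflateAll b)) (concat (map proj₂ Frame.classes))
      ≡⟨ sumBy-↭ _ Frame.classes-↭ ⟩
    inflateSum p ∎

  count-∞Class : ∀ p → count p ∞Class ≡ 𝟙 (p ∞tagged) + sum (λ i → count p (map (filled i) sixHoleBlocks))
  count-∞Class p = trans (count-∷ p ∞tagged _) (cong (𝟙 (p ∞tagged) +_) (begin
    count p (concat (map (λ i → map (filled i) sixHoleBlocks) (allFin n)))
      ≡⟨ count-concat p (map (λ i → map (filled i) sixHoleBlocks) (allFin n)) ⟩
    sumBy (count p) (map (λ i → map (filled i) sixHoleBlocks) (allFin n))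
      ≡⟨ sumBy-map (count p) (λ i → map (filled i) sixHoleBlocks) (allFin n) ⟩
    sumBy (λ i → count p (map (filled i) sixHoleBlocks)) (allFin n)
      ≡⟨ sumBy-tabulate (λ i → count p (map (filled i) sixHoleBlocks)) (λ i → i) ⟩
    sum (λ i → count p (map (filled i) sixHoleBlocks)) ∎))

  count-groupClasses : ∀ p i →
    sumBy (count p) (groupClasses i) ≡ sumBy (count p) (inflatedHoleClasses i) + count p (map (filled i) (concat nineClasses))
  count-groupClasses p i =
    trans (sumBy-count-zipWith-++ p (inflatedHoleClasses i) _ (length-inflatedHoleClasses i))
          (cong (sumBy (count p) (inflatedHoleClasses i) +_)
            (trans (sym (count-concat p (map (map (filled i)) nineClasses))) (cong (count p) (concat-map {f = filled i} nineClasses))))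

  count-blocks : ∀ p → count p blocks ≡ 𝟙 (p ∞tagged) + fillSum p + inflateSum p
  count-blocks p = begin
    count p blocks
      ≡⟨ count-concat p resolution ⟩
    count p ∞Class + sumBy (count p) (concat (map groupClasses (allFin n)))
      ≡⟨ cong₂ _+_ (count-∞Class p) (trans (sumBy-concat (count p) (map groupClasses (allFin n)))
           (trans (sumBy-map (sumBy (count p)) groupClasses (allFin n)) (sumBy-tabulate (λ i → sumBy (count p) (groupClasses i)) (λ i → i)))) ⟩
    𝟙 (p ∞tagged) + sum sixHole + sum (λ i → sumBy (count p) (groupClasses i))
      ≡⟨ cong (𝟙 (p ∞tagged) + sum sixHole +_) (trans (sum-cong-≗ (count-groupClasses p)) (∑-distrib-+ inflatedPart nine)) ⟩
    𝟙 (p ∞tagged) + sum sixHole + (sum inflatedPart + sum nine)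
      ≡⟨ cong (λ z → 𝟙 (p ∞tagged) + sum sixHole + (z + sum nine)) (sum-count-inflatedHoleClasses p) ⟩
    𝟙 (p ∞tagged) + sum sixHole + (inflateSum p + sum nine)
      ≡⟨ regroup (𝟙 (p ∞tagged)) (sum sixHole) (inflateSum p) (sum nine) ⟩
    𝟙 (p ∞tagged) + (sum nine + sum sixHole) + inflateSum p
      ≡⟨ cong (λ z → 𝟙 (p ∞tagged) + z + inflateSum p) (trans (sum-cong-≗ nine+sixHole) (∑-distrib-+ nine sixHole)) ⟨
    𝟙 (p ∞tagged) + fillSum p + inflateSum p ∎
    where
    open +-*-Solver
    sixHole nine inflatedPart : Fin n → ℕ
    sixHole i = count p (map (filled i) sixHoleBlocks)
    nine i = count p (map (filled i) (concat nineClasses))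
    inflatedPart i = sumBy (count p) (inflatedHoleClasses i)
    nine+sixHole : ∀ i → count p (map (filled i) fillBlocks) ≡ nine i + sixHole i
    nine+sixHole i = trans (cong (count p) (map-++ (filled i) (concat nineClasses) sixHoleBlocks))
                           (count-++ p (map (filled i) (concat nineClasses)) (map (filled i) sixHoleBlocks))
    regroup : ∀ a b c d → a + b + (c + d) ≡ a + (d + b) + c
    regroup = solve 4 (λ a b c d → a :+ b :+ (c :+ d) := a :+ (d :+ b) :+ c) refl

  lookup-wPart : ∀ i x → lookup (wPart i) x ≡ (lookup W x ∧ (x ∈ᵍ i))
  lookup-wPart i = lookup∘tabulate (λ x → lookup W x ∧ (x ∈ᵍ i))

  lookup-restPart : ∀ i x → lookup (restPart i) x ≡ (not (lookup W x) ∧ (x ∈ᵍ i))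
  lookup-restPart i = lookup∘tabulate (λ x → not (lookup W x) ∧ (x ∈ᵍ i))

  ∣wPart∣ : ∀ i → ∣ wPart i ∣ ≡ 3
  ∣wPart∣ i = trans (∣tabulate∣ (λ x → lookup W x ∧ (x ∈ᵍ i))) (Sub.groupPart-size i)

  ∣restPart∣ : ∀ i → ∣ restPart i ∣ ≡ 3
  ∣restPart∣ i = trans (∣tabulate∣ (λ x → not (lookup W x) ∧ (x ∈ᵍ i))) (+-cancelˡ-≡ 3 _ _ (begin
    3 + sum rest                    ≡⟨ cong (_+ sum rest) (Sub.groupPart-size i) ⟨
    sum inW + sum rest              ≡⟨ ∑-distrib-+ inW rest ⟨
    sum (λ x → inW x + rest x)      ≡⟨ sum-cong-≗ split ⟩
    sum (λ x → 𝟙 (x ∈ᵍ i))          ≡⟨ Frame.groupSize i ⟩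
    6                               ∎))
    where
    inW rest : Fin v → ℕ
    inW x = 𝟙 (lookup W x ∧ (x ∈ᵍ i))
    rest x = 𝟙 (not (lookup W x) ∧ (x ∈ᵍ i))
    split : ∀ x → inW x + rest x ≡ 𝟙 (x ∈ᵍ i)
    split x with lookup W x
    ... | true = +-identityʳ _
    ... | false = refl

  ∈wPart : ∀ i x → lookup W x ≡ true → (x ∈ᵍ i) ≡ true → lookup (wPart i) x ≡ true
  ∈wPart i x x∈W x∈i = trans (lookup-wPart i x) (cong₂ _∧_ x∈W x∈i)

  ∈restPart : ∀ i x → lookup W x ≡ false → (x ∈ᵍ i) ≡ true → lookup (restPart i) x ≡ true
  ∈restPart i x x∉W x∈i = trans (lookup-restPart i x) (cong₂ _∧_ (cong not x∉W) x∈i)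

  rank-wPart<3 : ∀ i x → lookup W x ≡ true → (x ∈ᵍ i) ≡ true → rank (wPart i) x < 3
  rank-wPart<3 i x x∈W x∈i = subst (rank (wPart i) x <_) (∣wPart∣ i) (rank<∣∣ (wPart i) x (∈wPart i x x∈W x∈i))

  rank-restPart<3 : ∀ i x → lookup W x ≡ false → (x ∈ᵍ i) ≡ true → rank (restPart i) x < 3
  rank-restPart<3 i x x∉W x∈i = subst (rank (restPart i) x <_) (∣restPart∣ i) (rank<∣∣ (restPart i) x (∈restPart i x x∉W x∈i))

  position<3 : ∀ i p → (p ∈ᵍ i) ≡ true → lookup W p ≡ true → position i p < 3
  position<3 i p p∈i p∈W rewrite p∈W = rank-wPart<3 i p p∈W p∈i

  position<6 : ∀ i p → (p ∈ᵍ i) ≡ true → position i p < 6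
  position<6 i p p∈i with lookup W p in w
  ... | true = ≤-trans (rank-wPart<3 i p w p∈i) (m≤n+m 3 3)
  ... | false = +-monoʳ-< 3 (rank-restPart<3 i p w p∈i)

  label<18 : ∀ i p α → (p ∈ᵍ i) ≡ true → label i (inj₁ (p , α)) < 18
  label<18 i p α p∈i = *3+-< (position i p) α 6 (position<6 i p p∈i)

  label<9 : ∀ i p α → (p ∈ᵍ i) ≡ true → lookup W p ≡ true → label i (inj₁ (p , α)) < 9
  label<9 i p α p∈i p∈W = *3+-< (position i p) α 3 (position<3 i p p∈i p∈W)

  label<21 : ∀ i q → inFill i q ≡ true → label i q < 21
  label<21 i (inj₁ (p , α)) p∈i = ≤-trans (label<18 i p α p∈i) (m≤n+m 18 3)
  label<21 i (inj₂ k) _ = +-monoʳ-< 18 (toℕ<n k)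

  position-injective : ∀ i p p′ → (p ∈ᵍ i) ≡ true → (p′ ∈ᵍ i) ≡ true → position i p ≡ position i p′ → p ≡ p′
  position-injective i p p′ p∈i p′∈i e with lookup W p in w | lookup W p′ in w′
  ... | true | true = rank-injective (wPart i) p p′ (∈wPart i p w p∈i) (∈wPart i p′ w′ p′∈i) e
  ... | false | false = rank-injective (restPart i) p p′ (∈restPart i p w p∈i) (∈restPart i p′ w′ p′∈i) (+-cancelˡ-≡ 3 _ _ e)
  ... | true | false = ⊥-elim (<-irrefl e (≤-trans (rank-wPart<3 i p w p∈i) (m≤m+n 3 _)))
  ... | false | true = ⊥-elim (<-irrefl (sym e) (≤-trans (rank-wPart<3 i p′ w′ p′∈i) (m≤m+n 3 _)))

  label-injective : ∀ i q q′ → inFill i q ≡ true → inFill i q′ ≡ true → q ≢ q′ → label i q ≢ label i q′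
  label-injective i (inj₁ (p , α)) (inj₁ (p′ , β)) p∈i p′∈i q≢q′ e with *3+-injective (position i p) (position i p′) α β e
  ... | same , refl with position-injective i p p′ p∈i p′∈i same
  ... | refl = q≢q′ refl
  label-injective i (inj₁ (p , α)) (inj₂ k) p∈i _ _ e = <-irrefl e (≤-trans (label<18 i p α p∈i) (m≤m+n 18 _))
  label-injective i (inj₂ k) (inj₁ (p , α)) _ p∈i _ e = <-irrefl (sym e) (≤-trans (label<18 i p α p∈i) (m≤m+n 18 _))
  label-injective i (inj₂ k) (inj₂ k′) _ _ q≢q′ e = q≢q′ (cong inj₂ (toℕ-injective (+-cancelˡ-≡ 18 _ _ e)))

  covers : Point → Point → TaggedBlock → Bool
  covers q q′ e = proj₁ e q ∧ proj₁ e q′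

  coversInSub : Point → Point → TaggedBlock → Bool
  coversInSub q q′ e = proj₂ e ∧ covers q q′ e

  count𝔽₃² : (Fin 3 → Fin 3 → Bool) → ℕ
  count𝔽₃² f = sumBy (λ s → count (f s) 𝔽₃) 𝔽₃

  count𝔽₃²-zero : ∀ f → (∀ s t → f s t ≡ false) → count𝔽₃² f ≡ 0
  count𝔽₃²-zero f never = sumBy-zeroᴬ {f = λ s → count (f s) 𝔽₃} (All.universal (λ s → count-zeroᴬ (All.universal (never s) 𝔽₃)) 𝔽₃)

  count-inflateAll : ∀ p b → count p (inflateAll b) ≡ count𝔽₃² (λ s t → p (inflated b s t))
  count-inflateAll p b = trans (count-concat p (map (λ s → map (inflated b s) 𝔽₃) 𝔽₃))
    (trans (sumBy-map (count p) (λ s → map (inflated b s) 𝔽₃) 𝔽₃) (sumBy-cong (λ s → count-map p (inflated b s) 𝔽₃) 𝔽₃))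

  rank<3 : ∀ (b : Subset v) p → ∣ b ∣ ≡ 3 → lookup b p ≡ true → rank b p < 3
  rank<3 b p ∣b∣≡3 p∈b = subst (rank b p <_) ∣b∣≡3 (rank<∣∣ b p p∈b)

  -- Two points of a block b on different coordinates lie on exactly one line.
  count-inflateAll-distinct : ∀ b p p′ α β → ∣ b ∣ ≡ 3 → p ≢ p′ →
    count (covers (inj₁ (p , α)) (inj₁ (p′ , β))) (inflateAll b) ≡ 𝟙 (lookup b p ∧ lookup b p′)
  count-inflateAll-distinct b p p′ α β ∣b∣≡3 p≢p′ =
    trans (count-inflateAll (covers (inj₁ (p , α)) (inj₁ (p′ , β))) b) (byMembership (lookup b p) (lookup b p′) refl refl)
    where
    byMembership : ∀ x y → lookup b p ≡ x → lookup b p′ ≡ y →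
      count𝔽₃² (λ s t → (x ∧ (α ≟ᵇ line s t (coordinate b p))) ∧ (y ∧ (β ≟ᵇ line s t (coordinate b p′)))) ≡ 𝟙 (x ∧ y)
    byMembership true true p∈b p′∈b = line-pair (coordinate b p) (coordinate b p′) α β
      (λ same → p≢p′ (rank-injective b p p′ p∈b p′∈b (mod3-injective (rank b p) (rank b p′) (rank<3 b p ∣b∣≡3 p∈b) (rank<3 b p′ ∣b∣≡3 p′∈b) same)))
    byMembership true false _ _ =
      count𝔽₃²-zero (λ s t → (true ∧ (α ≟ᵇ line s t (coordinate b p))) ∧ (false ∧ (β ≟ᵇ line s t (coordinate b p′)))) (λ s t → ∧-zeroʳ _)
    byMembership false y _ _ = refl

  count-inflateAll-sameBase : ∀ b p α β → α ≢ β → count (covers (inj₁ (p , α)) (inj₁ (p , β))) (inflateAll b) ≡ 0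
  count-inflateAll-sameBase b p α β α≢β =
    trans (count-inflateAll (covers (inj₁ (p , α)) (inj₁ (p , β))) b)
          (count𝔽₃²-zero (λ s t → covers (inj₁ (p , α)) (inj₁ (p , β)) (inflated b s t)) never)
    where
    never : ∀ s t → ((lookup b p ∧ (α ≟ᵇ line s t (coordinate b p))) ∧ (lookup b p ∧ (β ≟ᵇ line s t (coordinate b p)))) ≡ false
    never s t with lookup b p | α ≟ᵇ line s t (coordinate b p) in eα | β ≟ᵇ line s t (coordinate b p) in eβ
    ... | false | _ | _ = refl
    ... | true | false | _ = refl
    ... | true | true | false = refl
    ... | true | true | true = ⊥-elim (α≢β (trans (≟ᵇ-sound eα) (sym (≟ᵇ-sound eβ))))

  count-inflateAll-∞ : ∀ b q k → count (covers q (inj₂ k)) (inflateAll b) ≡ 0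
  count-inflateAll-∞ b q k =
    trans (count-inflateAll (covers q (inj₂ k)) b) (count𝔽₃²-zero (λ s t → covers q (inj₂ k) (inflated b s t)) (λ s t → ∧-zeroʳ _))

  count-inflateAll-inSub : ∀ b q q′ → count (coversInSub q q′) (inflateAll b) ≡ 𝟙 (b ⊆ᵇ W) * count (covers q q′) (inflateAll b)
  count-inflateAll-inSub b q q′ =
    trans (count-inflateAll (coversInSub q q′) b) (trans (byTag (b ⊆ᵇ W)) (cong (𝟙 (b ⊆ᵇ W) *_) (sym (count-inflateAll (covers q q′) b))))
    where
    byTag : ∀ x → count𝔽₃² (λ s t → x ∧ covers q q′ (inflated b s t)) ≡ 𝟙 x * count𝔽₃² (λ s t → covers q q′ (inflated b s t))
    byTag true = sym (+-identityʳ _)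
    byTag false = refl

  inflateSum-zero : ∀ q q′ → All (λ b → count (covers q q′) (inflateAll b) ≡ 0) B →
                    inflateSum (covers q q′) ≡ 0 × inflateSum (coversInSub q q′) ≡ 0
  inflateSum-zero q q′ none = sumBy-zeroᴬ none
    , sumBy-zeroᴬ (All.map (λ {b} e → trans (count-inflateAll-inSub b q q′)
                                         (trans (cong (𝟙 (b ⊆ᵇ W) *_) e) (*-zeroʳ (𝟙 (b ⊆ᵇ W))))) none)

  inflateSum-distinct : ∀ p p′ α β → p ≢ p′ → inflateSum (covers (inj₁ (p , α)) (inj₁ (p′ , β))) ≡ pairCount B p p′
  inflateSum-distinct p p′ α β p≢p′ =
    trans (sumBy-congᴬ (All.map (λ {b} ∣b∣≡3 → count-inflateAll-distinct b p p′ α β ∣b∣≡3 p≢p′) Frame.Blocks.triples))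
          (sym (count≡sumBy-𝟙 _ B))

  inflateSum-inSub-distinct : ∀ p p′ α β → p ≢ p′ →
    inflateSum (coversInSub (inj₁ (p , α)) (inj₁ (p′ , β))) ≡ count (λ b → (lookup b p ∧ lookup b p′) ∧ (b ⊆ᵇ W)) B
  inflateSum-inSub-distinct p p′ α β p≢p′ =
    trans (sumBy-congᴬ (All.map (λ {b} ∣b∣≡3 → trans (count-inflateAll-inSub b _ _)
            (trans (cong (𝟙 (b ⊆ᵇ W) *_) (count-inflateAll-distinct b p p′ α β ∣b∣≡3 p≢p′))
                   (trans (sym (𝟙-∧ (b ⊆ᵇ W) _)) (cong 𝟙 (∧-comm (b ⊆ᵇ W) _))))) Frame.Blocks.triples))
          (sym (count≡sumBy-𝟙 _ B))

  inflate-sameGroup : ∀ p p′ α β → grp p ≡ grp p′ → p ≢ p′ →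
    All (λ b → count (covers (inj₁ (p , α)) (inj₁ (p′ , β))) (inflateAll b) ≡ 0) B
  inflate-sameGroup p p′ α β same p≢p′ =
    All.zipWith (λ {b} (∣b∣≡3 , meetsOnce) → trans (count-inflateAll-distinct b p p′ α β ∣b∣≡3 p≢p′) (notBoth b meetsOnce))
                (Frame.Blocks.triples , Frame.Blocks.transversal)
    where
    notBoth : ∀ b → (∀ x y → x ∈ᵇ b ≡ true → y ∈ᵇ b ≡ true → grp x ≡ grp y → x ≡ y) → 𝟙 (lookup b p ∧ lookup b p′) ≡ 0
    notBoth b meetsOnce with lookup b p in p∈b | lookup b p′ in p′∈b
    ... | true | true = ⊥-elim (p≢p′ (meetsOnce p p′ p∈b p′∈b same))
    ... | true | false = refl
    ... | false | _ = refl

  ∈ᵍ-own : ∀ p → (p ∈ᵍ grp p) ≡ true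
  ∈ᵍ-own p = ≟ᵇ-refl (grp p)

  ∈ᵍ-other : ∀ p i → i ≢ grp p → (p ∈ᵍ i) ≡ false
  ∈ᵍ-other p i i≢p = ≟ᵇ-≢ (λ e → i≢p (sym e))

  ∈ᵍ-disjoint : ∀ p p′ → grp p ≢ grp p′ → ∀ i → ((p ∈ᵍ i) ∧ (p′ ∈ᵍ i)) ≡ false
  ∈ᵍ-disjoint p p′ other i with p ∈ᵍ i in p∈i
  ... | true = ∈ᵍ-other p′ i (λ e → other (trans (≟ᵇ-sound p∈i) e))
  ... | false = refl

  filled-outside : ∀ a b x y → (a ∧ b) ≡ false → ((a ∧ x) ∧ (b ∧ y)) ≡ false
  filled-outside true true x y ()
  filled-outside true false x y _ = ∧-zeroʳ _
  filled-outside false b x y _ = refl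

  filled-inside : ∀ a b x y → a ≡ true → b ≡ true → ((a ∧ x) ∧ (b ∧ y)) ≡ (x ∧ y)
  filled-inside a b x y refl refl = refl

  count-filled-outside : ∀ q q′ i → (inFill i q ∧ inFill i q′) ≡ false →
    count (covers q q′) (map (filled i) fillBlocks) ≡ 0 × count (coversInSub q q′) (map (filled i) fillBlocks) ≡ 0
  count-filled-outside q q′ i outside =
      trans (count-map (covers q q′) (filled i) fillBlocks)
            (count-zeroᴬ (All.universal (λ d → filled-outside (inFill i q) (inFill i q′) (d ∋ᵗ label i q) (d ∋ᵗ label i q′) outside) fillBlocks))
    , trans (count-map (coversInSub q q′) (filled i) fillBlocks)
            (count-zeroᴬ (All.universal (λ d → trans (cong (below9 d ∧_) (filled-outside (inFill i q) (inFill i q′) (d ∋ᵗ label i q) (d ∋ᵗ label i q′) outside))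
                                                     (∧-zeroʳ (below9 d))) fillBlocks))

  count-filled-inside : ∀ q q′ i → inFill i q ≡ true → inFill i q′ ≡ true →
    count (covers q q′) (map (filled i) fillBlocks) ≡ count (λ d → (d ∋ᵗ label i q) ∧ (d ∋ᵗ label i q′)) fillBlocks
    × count (coversInSub q q′) (map (filled i) fillBlocks) ≡ count (λ d → below9 d ∧ ((d ∋ᵗ label i q) ∧ (d ∋ᵗ label i q′))) fillBlocks
  count-filled-inside q q′ i q∈i q′∈i =
      trans (count-map (covers q q′) (filled i) fillBlocks)
            (count-cong (λ d → filled-inside (inFill i q) (inFill i q′) (d ∋ᵗ label i q) (d ∋ᵗ label i q′) q∈i q′∈i) fillBlocks)
    , trans (count-map (coversInSub q q′) (filled i) fillBlocks)
            (count-cong (λ d → cong (below9 d ∧_) (filled-inside (inFill i q) (inFill i q′) (d ∋ᵗ label i q) (d ∋ᵗ label i q′) q∈i q′∈i)) fillBlocks)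

  fillSum-zero : ∀ q q′ → (∀ i → (inFill i q ∧ inFill i q′) ≡ false) → fillSum (covers q q′) ≡ 0 × fillSum (coversInSub q q′) ≡ 0
  fillSum-zero q q′ outside =
    sum-zero (λ i → proj₁ (count-filled-outside q q′ i (outside i))) , sum-zero (λ i → proj₂ (count-filled-outside q q′ i (outside i)))

  fillSum-single : ∀ p α q′ → inFill (grp p) q′ ≡ true →
    fillSum (covers (inj₁ (p , α)) q′) ≡ count (λ d → (d ∋ᵗ label (grp p) (inj₁ (p , α))) ∧ (d ∋ᵗ label (grp p) q′)) fillBlocks
    × fillSum (coversInSub (inj₁ (p , α)) q′)
        ≡ count (λ d → below9 d ∧ ((d ∋ᵗ label (grp p) (inj₁ (p , α))) ∧ (d ∋ᵗ label (grp p) q′))) fillBlocks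
  fillSum-single p α q′ q′∈p =
      trans (sum-single _ (grp p) (λ i i≢p → proj₁ (count-filled-outside q q′ i (offGroup i i≢p)))) (proj₁ inside)
    , trans (sum-single _ (grp p) (λ i i≢p → proj₂ (count-filled-outside q q′ i (offGroup i i≢p)))) (proj₂ inside)
    where
    q = inj₁ (p , α)
    offGroup : ∀ i → i ≢ grp p → (inFill i q ∧ inFill i q′) ≡ false
    offGroup i i≢p rewrite ∈ᵍ-other p i i≢p = refl
    inside = count-filled-inside q q′ (grp p) (∈ᵍ-own p) q′∈p

  ∈ᵍ-sameGroup : ∀ p p′ → grp p ≡ grp p′ → (p′ ∈ᵍ grp p) ≡ true
  ∈ᵍ-sameGroup p p′ same = subst (λ j → (p′ ∈ᵍ j) ≡ true) (sym same) (∈ᵍ-own p′)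

  label-distinct : ∀ p α q′ → inFill (grp p) q′ ≡ true → inj₁ (p , α) ≢ q′ → label (grp p) (inj₁ (p , α)) ≢ label (grp p) q′
  label-distinct p α q′ q′∈p q≢q′ = label-injective (grp p) (inj₁ (p , α)) q′ (∈ᵍ-own p) q′∈p q≢q′

  count-covers-withinFill : ∀ p α q′ → inFill (grp p) q′ ≡ true → inj₁ (p , α) ≢ q′ →
    All (λ b → count (covers (inj₁ (p , α)) q′) (inflateAll b) ≡ 0) B → count (covers (inj₁ (p , α)) q′) blocks ≡ 1
  count-covers-withinFill p α q′ q′∈p q≢q′ notInflated =
    trans (count-blocks (covers (inj₁ (p , α)) q′))
          (cong₂ _+_ (trans (proj₁ (fillSum-single p α q′ q′∈p))
                            (fill-pairCount _ _ (label<18 (grp p) p α (∈ᵍ-own p)) (label<21 (grp p) q′ q′∈p) (label-distinct p α q′ q′∈p q≢q′)))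
                     (proj₁ (inflateSum-zero (inj₁ (p , α)) q′ notInflated)))

  count-coversInSub-withinFill : ∀ p α p′ β → (p′ ∈ᵍ grp p) ≡ true → lookup W p ≡ true → lookup W p′ ≡ true →
    inj₁ (p , α) ≢ inj₁ (p′ , β) → All (λ b → count (covers (inj₁ (p , α)) (inj₁ (p′ , β))) (inflateAll b) ≡ 0) B →
    count (coversInSub (inj₁ (p , α)) (inj₁ (p′ , β))) blocks ≡ 1
  count-coversInSub-withinFill p α p′ β p′∈p p∈W p′∈W q≢q′ notInflated =
    trans (count-blocks (coversInSub (inj₁ (p , α)) (inj₁ (p′ , β))))
          (cong₂ _+_ (trans (proj₂ (fillSum-single p α (inj₁ (p′ , β)) p′∈p))
                            (fill-subPairCount _ _ (label<9 (grp p) p α (∈ᵍ-own p) p∈W) (label<9 (grp p) p′ β p′∈p p′∈W)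
                                               (label-distinct p α (inj₁ (p′ , β)) p′∈p q≢q′)))
                     (proj₂ (inflateSum-zero (inj₁ (p , α)) (inj₁ (p′ , β)) notInflated)))

  count-covers-otherGroups : ∀ p α p′ β → grp p ≢ grp p′ → count (covers (inj₁ (p , α)) (inj₁ (p′ , β))) blocks ≡ 1
  count-covers-otherGroups p α p′ β other =
    trans (count-blocks (covers (inj₁ (p , α)) (inj₁ (p′ , β))))
          (cong₂ _+_ (proj₁ (fillSum-zero (inj₁ (p , α)) (inj₁ (p′ , β)) (∈ᵍ-disjoint p p′ other)))
                     (trans (inflateSum-distinct p p′ α β (λ e → other (cong grp e))) (Frame.pairCount-otherGroup p p′ other)))

  count-coversInSub-otherGroups : ∀ p α p′ β → lookup W p ≡ true → lookup W p′ ≡ true → grp p ≢ grp p′ →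
    count (coversInSub (inj₁ (p , α)) (inj₁ (p′ , β))) blocks ≡ 1
  count-coversInSub-otherGroups p α p′ β p∈W p′∈W other =
    trans (count-blocks (coversInSub (inj₁ (p , α)) (inj₁ (p′ , β))))
          (cong₂ _+_ (proj₂ (fillSum-zero (inj₁ (p , α)) (inj₁ (p′ , β)) (∈ᵍ-disjoint p p′ other)))
                     (trans (inflateSum-inSub-distinct p p′ α β (λ e → other (cong grp e)))
                            (Subframe.pairCount-inside p p′ p∈W p′∈W other)))

  count-covers-∞ : ∀ k k′ → k ≢ k′ → count (covers (inj₂ k) (inj₂ k′)) blocks ≡ 1
  count-covers-∞ k k′ k≢k′ =
    trans (count-blocks (covers (inj₂ k) (inj₂ k′)))
          (cong₂ (λ a b → 1 + a + b)
                 (sum-zero (λ i → trans (count-map (covers (inj₂ k) (inj₂ k′)) (filled i) fillBlocks) (fill-pairCount-∞ k k′ k≢k′)))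
                 (proj₁ (inflateSum-zero (inj₂ k) (inj₂ k′) (All.universal (λ b → count-inflateAll-∞ b (inj₂ k) k′) B))))

  count-covers : ∀ q q′ → q ≢ q′ → count (covers q q′) blocks ≡ 1
  count-covers (inj₁ (p , α)) (inj₁ (p′ , β)) q≢q′ with grp p ≟ grp p′ | p ≟ p′
  ... | no other | _ = count-covers-otherGroups p α p′ β other
  ... | yes same | no p≢p′ =
    count-covers-withinFill p α (inj₁ (p′ , β)) (∈ᵍ-sameGroup p p′ same) q≢q′ (inflate-sameGroup p p′ α β same p≢p′)
  ... | yes _ | yes refl =
    count-covers-withinFill p α (inj₁ (p , β)) (∈ᵍ-own p) q≢q′
      (All.universal (λ b → count-inflateAll-sameBase b p α β (λ α≡β → q≢q′ (cong (λ γ → inj₁ (p , γ)) α≡β))) B)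
  count-covers (inj₁ (p , α)) (inj₂ k) q≢q′ =
    count-covers-withinFill p α (inj₂ k) refl q≢q′ (All.universal (λ b → count-inflateAll-∞ b (inj₁ (p , α)) k) B)
  count-covers (inj₂ k) (inj₁ x) q≢q′ =
    trans (count-cong (λ e → ∧-comm (proj₁ e (inj₂ k)) (proj₁ e (inj₁ x))) blocks) (count-covers (inj₁ x) (inj₂ k) (λ e → q≢q′ (sym e)))
  count-covers (inj₂ k) (inj₂ k′) q≢q′ = count-covers-∞ k k′ (λ k≡k′ → q≢q′ (cong inj₂ k≡k′))

  count-coversInSub : ∀ p α p′ β → lookup W p ≡ true → lookup W p′ ≡ true → inj₁ (p , α) ≢ inj₁ (p′ , β) →
    count (coversInSub (inj₁ (p , α)) (inj₁ (p′ , β))) blocks ≡ 1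
  count-coversInSub p α p′ β p∈W p′∈W q≢q′ with grp p ≟ grp p′ | p ≟ p′
  ... | no other | _ = count-coversInSub-otherGroups p α p′ β p∈W p′∈W other
  ... | yes same | no p≢p′ =
    count-coversInSub-withinFill p α p′ β (∈ᵍ-sameGroup p p′ same) p∈W p′∈W q≢q′ (inflate-sameGroup p p′ α β same p≢p′)
  ... | yes _ | yes refl =
    count-coversInSub-withinFill p α p β (∈ᵍ-own p) p∈W p′∈W q≢q′
      (All.universal (λ b → count-inflateAll-sameBase b p α β (λ α≡β → q≢q′ (cong (λ γ → inj₁ (p , γ)) α≡β))) B)

  contains : Point → TaggedBlock → Bool
  contains q e = proj₁ e q

  ∞Class-parallel : ∀ q → count (contains q) ∞Class ≡ 1
  ∞Class-parallel q = trans (count-∞Class (contains q)) (byPoint q)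
    where
    byPoint : ∀ q → 𝟙 (∞Block q) + sum (λ i → count (contains q) (map (filled i) sixHoleBlocks)) ≡ 1
    byPoint (inj₁ (p , α)) = trans (sum-single _ (grp p) offGroup) (trans (count-map (contains (inj₁ (p , α))) (filled (grp p)) sixHoleBlocks)
      (trans (count-cong (λ d → cong (_∧ (d ∋ᵗ label (grp p) (inj₁ (p , α)))) (∈ᵍ-own p)) sixHoleBlocks)
             (sixHoleBlocks-cover _ (label<18 (grp p) p α (∈ᵍ-own p)))))
      where
      offGroup : ∀ i → i ≢ grp p → count (contains (inj₁ (p , α))) (map (filled i) sixHoleBlocks) ≡ 0
      offGroup i i≢p = trans (count-map (contains (inj₁ (p , α))) (filled i) sixHoleBlocks)
        (trans (count-cong (λ d → cong (_∧ (d ∋ᵗ label i (inj₁ (p , α)))) (∈ᵍ-other p i i≢p)) sixHoleBlocks) (count-false sixHoleBlocks))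
    byPoint (inj₂ k) = cong suc (sum-zero (λ i → trans (count-map (contains (inj₂ k)) (filled i) sixHoleBlocks) (sixHoleBlocks-miss-∞ k)))

  outsideHole : Fin n → Point → Bool
  outsideHole i (inj₁ (p , α)) = not (p ∈ᵍ i)
  outsideHole i (inj₂ k) = false

  inflateClass-partial : ∀ i P → IsHoleClass grp i P → ∀ s q → count (contains q) (inflateClass P s) ≡ 𝟙 (outsideHole i q)
  inflateClass-partial i P hole s q =
    trans (count-inflateClass (contains q) P s) (trans (sumBy-cong (λ b → count-map (contains q) (inflated b s) 𝔽₃) P) (byPoint q))
    where
    byPoint : ∀ q → sumBy (λ b → count (λ t → inflate b s t q) 𝔽₃) P ≡ 𝟙 (outsideHole i q)
    byPoint (inj₁ (p , α)) = trans (sumBy-cong onLines P) (trans (sym (count≡sumBy-𝟙 _ P)) partition)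
      where
      onLines : ∀ b → count (λ t → inflate b s t (inj₁ (p , α))) 𝔽₃ ≡ 𝟙 (lookup b p)
      onLines b with lookup b p
      ... | true = line-parallel s (coordinate b p) α
      ... | false = refl
      partition : pointCount P p ≡ 𝟙 (not (p ∈ᵍ i))
      partition with grp p ≟ i
      ... | yes p∈i = proj₁ (hole p) p∈i
      ... | no p∉i = proj₂ (hole p) p∉i
    byPoint (inj₂ k) = sumBy-zeroᴬ (All.universal (λ b → refl) P)

  nineFilledClasses-partial : ∀ i → All (λ C → ∀ q → count (contains q) C ≡ 𝟙 (inFill i q)) (map (map (filled i)) nineClasses)
  nineFilledClasses-partial i =
    All.map⁺ {f = map (filled i)}
      (All.map (λ {C} parallel q → trans (count-map (contains q) (filled i) C) (byPoint C parallel q)) nineClasses-parallel)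
    where
    byPoint : ∀ C → (∀ m → m < 21 → count (_∋ᵗ m) C ≡ 1) → ∀ q → count (λ d → fill i d q) C ≡ 𝟙 (inFill i q)
    byPoint C parallel q with inFill i q in q∈i
    ... | true = parallel (label i q) (label<21 i q q∈i)
    ... | false = count-false C

  classes-triples : All (λ c → AllTriples (proj₂ c)) Frame.classes
  classes-triples = All.map⁻ (All.concat⁻ (All-resp-↭ (↭-sym Frame.classes-↭) Frame.Blocks.triples))

  holesAt-classes : ∀ i → All (λ P → IsHoleClass grp i P × AllTriples P) (holesAt i Frame.classes)
  holesAt-classes i = holesAt-All (λ j P → IsHoleClass grp j P × AllTriples P) i Frame.classes (All.zip (Frame.classes-holes , classes-triples))

  inflatedHoleClasses-partial : ∀ i → All (λ C → ∀ q → count (contains q) C ≡ 𝟙 (outsideHole i q)) (inflatedHoleClasses i)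
  inflatedHoleClasses-partial i =
    All.concat⁺ (All.map⁺ {f = λ P → map (inflateClass P) 𝔽₃}
      (All.map (λ {P} (hole , _) → All.map⁺ {f = inflateClass P} (All.universal (λ s → inflateClass-partial i P hole s) 𝔽₃)) (holesAt-classes i)))

  outsideHole+inFill : ∀ i q → 𝟙 (outsideHole i q) + 𝟙 (inFill i q) ≡ 1
  outsideHole+inFill i (inj₁ (p , α)) = trans (+-comm (𝟙 (not (p ∈ᵍ i))) (𝟙 (p ∈ᵍ i))) (𝟙-+-𝟙-not (p ∈ᵍ i))
  outsideHole+inFill i (inj₂ k) = refl

  groupClasses-parallel : ∀ i → All (λ C → ∀ q → count (contains q) C ≡ 1) (groupClasses i)
  groupClasses-parallel i = zipWith-++ (inflatedHoleClasses-partial i) (nineFilledClasses-partial i)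
    where
    zipWith-++ : ∀ {Xs Ys} → All (λ C → ∀ q → count (contains q) C ≡ 𝟙 (outsideHole i q)) Xs →
                 All (λ C → ∀ q → count (contains q) C ≡ 𝟙 (inFill i q)) Ys →
                 All (λ C → ∀ q → count (contains q) C ≡ 1) (zipWith _++_ Xs Ys)
    zipWith-++ [] _ = []
    zipWith-++ (_ ∷ _) [] = []
    zipWith-++ {X ∷ _} {Y ∷ _} (outside ∷ outsides) (inside ∷ insides) =
      (λ q → trans (count-++ (contains q) X Y) (trans (cong₂ _+_ (outside q) (inside q)) (outsideHole+inFill i q)))
      ∷ zipWith-++ outsides insides

  resolution-parallel : All (λ C → ∀ q → count (contains q) C ≡ 1) resolution
  resolution-parallel = ∞Class-parallel ∷ All.concat⁺ (All.map⁺ (All.tabulate⁺ groupClasses-parallel))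

  size : Block → ℕ
  size χ = sum (λ x → sum (λ (α : Fin 3) → 𝟙 (χ (inj₁ (x , α))))) + sum (λ (k : Fin 3) → 𝟙 (χ (inj₂ k)))

  subPoints : Block
  subPoints (inj₁ (p , α)) = lookup W p
  subPoints (inj₂ k) = false

  IsFlaggedTriple : TaggedBlock → Set
  IsFlaggedTriple e = size (proj₁ e) ≡ 3 × (proj₂ e ≡ true → ∀ q → proj₁ e q ≡ true → subPoints q ≡ true)

  inflated-flaggedTriple : ∀ b s t → ∣ b ∣ ≡ 3 → IsFlaggedTriple (inflated b s t)
  inflated-flaggedTriple b s t ∣b∣≡3 = triple , insideW
    where
    onePerPoint : ∀ x → sum (λ (α : Fin 3) → 𝟙 (lookup b x ∧ (α ≟ᵇ line s t (coordinate b x)))) ≡ 𝟙 (lookup b x)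
    onePerPoint x with lookup b x
    ... | true = trans (sum-cong-≗ (λ α → cong 𝟙 (≟ᵇ-comm α (line s t (coordinate b x))))) (sum-𝟙-≟ᵇ (line s t (coordinate b x)))
    ... | false = sum-zero {3} (λ _ → refl)
    triple : size (inflate b s t) ≡ 3
    triple = trans (+-identityʳ _) (trans (sum-cong-≗ onePerPoint) (trans (sym (∣∣≡sum-𝟙 b)) ∣b∣≡3))
    insideW : (b ⊆ᵇ W) ≡ true → ∀ q → inflate b s t q ≡ true → subPoints q ≡ true
    insideW b⊆W (inj₁ (p , α)) p∈ with lookup b p in p∈b
    ... | true = ⊆ᵇ-sound b W b⊆W p p∈b

  filled-flaggedTriple : ∀ i d → labelCount d ≡ 3 → IsFlaggedTriple (filled i d)
  filled-flaggedTriple i d three = triple , insideW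
    where
    g : ℕ → ℕ
    g m = sum (λ (α : Fin 3) → 𝟙 (d ∋ᵗ (m * 3 + toℕ α)))
    fromW fromRest : Fin v → ℕ
    fromW x = if lookup (wPart i) x then g (rank (wPart i) x) else 0
    fromRest x = if lookup (restPart i) x then g (3 + rank (restPart i) x) else 0
    byPart : ∀ x → sum (λ (α : Fin 3) → 𝟙 ((x ∈ᵍ i) ∧ (d ∋ᵗ (position i x * 3 + toℕ α)))) ≡ fromW x + fromRest x
    byPart x rewrite lookup-wPart i x | lookup-restPart i x with x ∈ᵍ i | lookup W x
    ... | true | true = sym (+-identityʳ _)
    ... | true | false = refl
    ... | false | true = sum-zero {3} (λ _ → refl)
    ... | false | false = sum-zero {3} (λ _ → refl)
    triple : size (fill i d) ≡ 3
    triple = trans (cong (_+ sum (λ (k : Fin 3) → 𝟙 (d ∋ᵗ (18 + toℕ k)))) (begin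
      sum (λ x → sum (λ (α : Fin 3) → 𝟙 ((x ∈ᵍ i) ∧ (d ∋ᵗ (position i x * 3 + toℕ α)))))
        ≡⟨ trans (sum-cong-≗ byPart) (∑-distrib-+ fromW fromRest) ⟩
      sum fromW + sum fromRest
        ≡⟨ cong₂ _+_ (sum-by-rank (wPart i) g) (sum-by-rank (restPart i) (λ m → g (3 + m))) ⟩
      sumBelow (∣ wPart i ∣) g + sumBelow (∣ restPart i ∣) (λ m → g (3 + m))
        ≡⟨ cong₂ (λ a b → sumBelow a g + sumBelow b (λ m → g (3 + m))) (∣wPart∣ i) (∣restPart∣ i) ⟩
      sumBelow 3 g + sumBelow 3 (λ m → g (3 + m))
        ≡⟨ sumBelow-+ 3 3 g ⟨
      sumBelow 6 g ∎)) three
    insideW : below9 d ≡ true → ∀ q → fill i d q ≡ true → subPoints q ≡ true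
    insideW below (inj₁ (p , α)) p∈d with p ∈ᵍ i | lookup W p in p∈W
    ... | true | true = refl
    ... | true | false = ⊥-elim (<-irrefl refl (≤-trans (below9-∋ᵗ d _ below p∈d)
                                                        (≤-trans (*-monoˡ-≤ 3 (m≤m+n 3 (rank (restPart i) p))) (m≤m+n _ (toℕ α)))))
    insideW below (inj₂ k) ∞∈d = ⊥-elim (<-irrefl refl (≤-trans (below9-∋ᵗ d _ below ∞∈d) (m≤m+n 9 (9 + toℕ k))))

  ∞-flaggedTriple : IsFlaggedTriple ∞tagged
  ∞-flaggedTriple = cong (_+ 3) (sum-zero {v} (λ _ → refl)) , λ ()

  blocks-flaggedTriple : All IsFlaggedTriple blocks
  blocks-flaggedTriple = All.concat⁺ (∞Class-flagged ∷ All.concat⁺ (All.map⁺ {f = groupClasses} (All.tabulate⁺ groupClasses-flagged)))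
    where
    fillBlocks-flagged : ∀ i → All (λ d → IsFlaggedTriple (filled i d)) fillBlocks
    fillBlocks-flagged i = All.map (filled-flaggedTriple i _) fill-labelCount
    ∞Class-flagged : All IsFlaggedTriple ∞Class
    ∞Class-flagged = ∞-flaggedTriple ∷ All.concat⁺ (All.map⁺ {f = λ i → map (filled i) sixHoleBlocks}
      (All.tabulate⁺ (λ i → All.map⁺ {f = filled i} (All.++⁻ʳ (concat nineClasses) (fillBlocks-flagged i)))))
    groupClasses-flagged : ∀ i → All (All IsFlaggedTriple) (groupClasses i)
    groupClasses-flagged i = zipWith-++ inflatedFlagged filledFlagged
      where
      zipWith-++ : ∀ {Xs Ys} → All (All IsFlaggedTriple) Xs → All (All IsFlaggedTriple) Ys → All (All IsFlaggedTriple) (zipWith _++_ Xs Ys)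
      zipWith-++ [] _ = []
      zipWith-++ (_ ∷ _) [] = []
      zipWith-++ (x ∷ xs) (y ∷ ys) = All.++⁺ x y ∷ zipWith-++ xs ys
      inflatedFlagged : All (All IsFlaggedTriple) (inflatedHoleClasses i)
      inflatedFlagged = All.concat⁺ (All.map⁺ {f = λ P → map (inflateClass P) 𝔽₃} (All.map (λ {P} (_ , triples) →
        All.map⁺ {f = inflateClass P} (All.universal (λ s → All.concat⁺ (All.map⁺ {f = λ b → map (inflated b s) 𝔽₃}
          (All.map (λ {b} ∣b∣≡3 → All.map⁺ {f = inflated b s} (All.universal (λ t → inflated-flaggedTriple b s t ∣b∣≡3) 𝔽₃)) triples))) 𝔽₃))
        (holesAt-classes i)))
      filledFlagged : All (All IsFlaggedTriple) (map (map (filled i)) nineClasses)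
      filledFlagged = All.map⁺ {f = map (filled i)}
        (All.map (All.map⁺ {f = filled i}) (All.concat⁻ (All.++⁻ˡ (concat nineClasses) (fillBlocks-flagged i))))

  N : ℕ
  N = v * 3 + 3

  decode : Fin N → Point
  decode q = [ (λ r → inj₁ (remQuot {v} 3 r)) , inj₂ ]′ (splitAt (v * 3) q)

  encode : Point → Fin N
  encode (inj₁ (x , α)) = join (v * 3) 3 (inj₁ (combine x α))
  encode (inj₂ k) = join (v * 3) 3 (inj₂ k)

  encode∘decode : ∀ q → encode (decode q) ≡ q
  encode∘decode q with splitAt (v * 3) q in eq
  ... | inj₁ r = trans (cong (λ z → join (v * 3) 3 (inj₁ z)) (combine-remQuot {v} 3 r))
                       (trans (cong (join (v * 3) 3) (sym eq)) (join-splitAt (v * 3) 3 q))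
  ... | inj₂ k = trans (cong (join (v * 3) 3) (sym eq)) (join-splitAt (v * 3) 3 q)

  decode-injective : ∀ q q′ → decode q ≡ decode q′ → q ≡ q′
  decode-injective q q′ e = trans (sym (encode∘decode q)) (trans (cong encode e) (encode∘decode q′))

  sum-decode : ∀ (f : Point → ℕ) →
    sum (λ q → f (decode q)) ≡ sum (λ x → sum (λ (α : Fin 3) → f (inj₁ (x , α)))) + sum (λ (k : Fin 3) → f (inj₂ k))
  sum-decode f = trans (sum-splitAt (v * 3) 3 (λ s → f ([ (λ r → inj₁ (remQuot {v} 3 r)) , inj₂ ]′ s)))
                       (cong (_+ sum (λ (k : Fin 3) → f (inj₂ k))) (sum-remQuot v 3 (λ p → f (inj₁ p))))

  toSubset : Block → Subset N
  toSubset χ = tabulate (λ q → χ (decode q))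

  lookup-toSubset : ∀ χ q → lookup (toSubset χ) q ≡ χ (decode q)
  lookup-toSubset χ = lookup∘tabulate (λ q → χ (decode q))

  ∣toSubset∣ : ∀ χ → ∣ toSubset χ ∣ ≡ size χ
  ∣toSubset∣ χ = trans (∣tabulate∣ (λ q → χ (decode q))) (sum-decode (λ q → 𝟙 (χ q)))

  count-toSubset : ∀ (p : Subset N → Bool) (p′ : TaggedBlock → Bool) → (∀ e → p (toSubset (proj₁ e)) ≡ p′ e) →
                   ∀ es → count p (map (λ e → toSubset (proj₁ e)) es) ≡ count p′ es
  count-toSubset p p′ agree es = trans (count-map p _ es) (count-cong agree es)

  kts : KTSWithSub N (9 * n)
  kts = map blockSubset blocks , toSubset subPoints , (sts , resolvable) , ∣sub∣ , subdesign
    where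
    blockSubset : TaggedBlock → Subset N
    blockSubset e = toSubset (proj₁ e)
    pairCount-blockSubset : ∀ es x y → pairCount (map blockSubset es) x y ≡ count (covers (decode x) (decode y)) es
    pairCount-blockSubset es x y =
      count-toSubset _ _ (λ e → cong₂ _∧_ (lookup-toSubset (proj₁ e) x) (lookup-toSubset (proj₁ e) y)) es
    sts : IsSTS N (map blockSubset blocks)
    sts = All.map⁺ (All.map (λ {e} flagged → trans (∣toSubset∣ (proj₁ e)) (proj₁ flagged)) blocks-flaggedTriple)
        , λ x y x≢y → trans (pairCount-blockSubset blocks x y) (count-covers (decode x) (decode y) (λ e → x≢y (decode-injective x y e)))
    resolvable : Resolvable (map blockSubset blocks)
    resolvable = map (map blockSubset) resolution , ↭-reflexive (concat-map {f = blockSubset} resolution)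
               , All.map⁺ (All.map (λ {C} parallel x →
                   trans (count-toSubset _ (contains (decode x)) (λ e → lookup-toSubset (proj₁ e) x) C) (parallel (decode x)))
                                   resolution-parallel)
    ∣sub∣ : ∣ toSubset subPoints ∣ ≡ 9 * n
    ∣sub∣ = begin
      ∣ toSubset subPoints ∣                              ≡⟨ ∣toSubset∣ subPoints ⟩
      sum (λ x → sum (λ (α : Fin 3) → 𝟙 (lookup W x))) + 0  ≡⟨ +-identityʳ _ ⟩
      sum (λ x → sum (λ (α : Fin 3) → 𝟙 (lookup W x)))      ≡⟨ sum-cong-≗ (λ x → sum-const 3 (𝟙 (lookup W x))) ⟩
      sum (λ x → 3 * 𝟙 (lookup W x))                      ≡⟨ *-distribˡ-sum 3 (λ x → 𝟙 (lookup W x)) ⟩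
      3 * sum (λ x → 𝟙 (lookup W x))                      ≡⟨ cong (3 *_) Sub.size ⟩
      3 * (n * 3)                                         ≡⟨ cong (3 *_) (*-comm n 3) ⟩
      3 * (3 * n)                                         ≡⟨ *-assoc 3 3 n ⟨
      9 * n                                               ∎
    subBlocks : List TaggedBlock
    subBlocks = filterᵇ proj₂ blocks
    subdesign : HasSubdesign (map blockSubset blocks) (toSubset subPoints)
    subdesign = map blockSubset subBlocks , ⊆-map⁺ blockSubset (filterᵇ-⊆ proj₂ blocks)
              , All.map⁺ (All-filterᵇ proj₂ (All.map (λ {e} flagged flag z z∈e →
                  trans (lookup-toSubset subPoints z) (proj₂ flagged flag (decode z) (trans (sym (lookup-toSubset (proj₁ e) z)) z∈e)))
                  blocks-flaggedTriple))
              , λ x y x∈ y∈ x≢y → trans (pairCount-blockSubset subBlocks x y)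
                  (trans (count-filterᵇ (covers (decode x) (decode y)) proj₂ blocks)
                         (bySub (decode x) (decode y) (trans (sym (lookup-toSubset subPoints x)) x∈) (trans (sym (lookup-toSubset subPoints y)) y∈)
                                (λ e → x≢y (decode-injective x y e))))
      where
      bySub : ∀ q q′ → subPoints q ≡ true → subPoints q′ ≡ true → q ≢ q′ → count (coversInSub q q′) blocks ≡ 1
      bySub (inj₁ (p , α)) (inj₁ (p′ , β)) p∈W p′∈W q≢q′ = count-coversInSub p α p′ β p∈W p′∈W q≢q′

  N≡18n+3 : N ≡ 18 * n + 3
  N≡18n+3 = cong (_+ 3) (trans (cong (_* 3) Frame.v≡u*h) (trans (*-assoc n 6 3) (*-comm n 18)))

lemma4p9 : (n : ℕ) → 0 < n → KirkmanFrameGH 3 6 n → KTSWithSub (18 * n + 3) (9 * n)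
lemma4p9 zero () _
lemma4p9 (suc zero) _ _ = kts21
lemma4p9 n@(suc (suc _)) _ (v , grp , B , W , A , frame , gdd , A⊆B) =
  subst (λ N → KTSWithSub N (9 * n)) N≡18n+3 kts
  where open Construction grp B W A frame gdd A⊆B (s≤s (s≤s z≤n))
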